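{- Let $(p_\lambda(\mathbf y))_\lambda$ be the full sequence of symmetric functions of binomial type associated with the quasi-genus $(G_\lambda)_\lambda$. Then $$\mathbf D\,p_\lambda(\mathbf y)=\sum_{i\ge1}i\,G_{(1)}\,\mathrm{mult}_i(\lambda)\,p_{\mu^{(i)}}(\mathbf y),\qquad \mu^{(i)}=(\lambda\setminus i)\cup(i-1),$$ (terms with $\mathrm{mult}_i(\lambda)=0$ vanish), and more generally for every $n\ge1$ $$\mathbf D_n\,p_\lambda(\mathbf y)=n!\sum_{|\alpha|=n}\binom\lambda\alpha G_\alpha\, p_{\lambda-\alpha}(\mathbf y),$$ the sum over vectors $\alpha$ of nonnegative integers with $\alpha\le\lambda$ componentwise and $|\alpha|=\sum_i\alpha_i=n$.
   Context: A quasi-genus is a family of complex numbers $(G_\lambda)$ indexed by partitions with $G_{(0)}=1$, $G_{(1)}\neq0$. The sequence associated with it is $p_\lambda(\mathbf y)=\sum_{f:S\to\{1,2,\dots\}}\prod_{k\ge1}G_{\mathrm{type}(\pi|_{f^{ -1}(k)})}\prod_{s\in S}y_{f(s)}$, where $S$ is a finite set with a set partition $\pi$ of type $\lambda$ (type = integer partition of block sizes; $\pi|_T$ = nonempty intersections of blocks with $T$); it is assumed full, i.e. each $p_\lambda$ is homogeneous whose largest monomial $m_\mu$ (in reverse lexicographic order) with nonzero coefficient is $m_\lambda$. For vectors $\alpha$, $G_\alpha$ and $p_\alpha$ mean $G_\mu$, $p_\mu$ with $\mu$ the decreasing rearrangement of $\alpha$; $\binom\lambda\alpha=\lambda!/(\alpha!(\lambda-\alpha)!)$,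 $\alpha!=\prod\alpha_i!$. $\mathrm{mult}_i(\lambda)$ is the number of parts equal to $i$; $(\lambda\setminus i)\cup(i-1)$ replaces one part $i$ by $i-1$. $\mathbf D_i$ is the linear operator on symmetric functions with $\mathbf D_im_\lambda=i!\,m_{\lambda\setminus i}$ if $i$ is a part of $\lambda$, else $0$; $\mathbf D=\mathbf D_1$. -}

module Defs where

open import Level using (Level)
open import Algebra.Bundles using (CommutativeRing)
open import Data.Bool using (Bool; true; false; if_then_else_; _∧_)
open import Data.Nat using (ℕ; zero; suc; _∸_; _!; _<_; _≥_; _≤ᵇ_; _≡ᵇ_)
open import Data.Nat.Combinatorics using (_C_)
open import Data.Nat.ListAction using (sum; product)
open import Data.Bool.ListAction using (and)
open import Data.List using (List; []; _∷_; map; foldr; zip; zipWith; upTo; concatMap; length; applyUpTo)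
open import Data.List.Relation.Unary.All using (All)
open import Data.List.Relation.Unary.Linked using (Linked)
open import Data.Product using (_×_; _,_)
open import Data.Sum using (_⊎_)
open import Data.Empty using (⊥)
open import Relation.Binary.PropositionalEquality using (_≡_; _≢_)
open import Relation.Nullary using (¬_)

IsPartition : List ℕ → Set
IsPartition l = All (0 <_) l × Linked _≥_ l

insertDesc : ℕ → List ℕ → List ℕ
insertDesc x [] = x ∷ []
insertDesc x (y ∷ ys) = if y ≤ᵇ x then x ∷ y ∷ ys else y ∷ insertDesc x ys

dropZeros : List ℕ → List ℕ
dropZeros [] = []
dropZeros (zero ∷ xs) = dropZeros xs
dropZeros (suc x ∷ xs) = suc x ∷ dropZeros xs

normalize : List ℕ → List ℕ
normalize xs = foldr insertDesc [] (dropZeros xs)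

mult : ℕ → List ℕ → ℕ
mult i [] = 0
mult i (x ∷ xs) = if x ≡ᵇ i then suc (mult i xs) else mult i xs

replaceFirst : ℕ → ℕ → List ℕ → List ℕ
replaceFirst i j [] = []
replaceFirst i j (x ∷ xs) = if x ≡ᵇ i then j ∷ xs else x ∷ replaceFirst i j xs

replaceOne : ℕ → List ℕ → List ℕ
replaceOne i l = normalize (replaceFirst i (i ∸ 1) l)

LexGt : List ℕ → List ℕ → Set
LexGt [] ys = ⊥
LexGt (x ∷ xs) [] = 0 < x ⊎ (x ≡ 0 × LexGt xs [])
LexGt (x ∷ xs) (y ∷ ys) = y < x ⊎ (x ≡ y × LexGt xs ys)

colorings : ℕ → ℕ → List (List ℕ)
colorings m zero = [] ∷ []
colorings m (suc k) = concatMap (λ c → map (c ∷_) (colorings m k)) (upTo m)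

vecsBelow : List ℕ → List (List ℕ)
vecsBelow [] = [] ∷ []
vecsBelow (x ∷ xs) = concatMap (λ a → map (a ∷_) (vecsBelow xs)) (upTo (suc x))

vecsBelowOfSize : List ℕ → ℕ → List (List ℕ)
vecsBelowOfSize l n = filt (vecsBelow l)
  where
  filt : List (List ℕ) → List (List ℕ)
  filt [] = []
  filt (a ∷ as) = if sum a ≡ᵇ n then a ∷ filt as else filt as

binomVec : List ℕ → List ℕ → ℕ
binomVec l a = product (zipWith _C_ l a)

-- the canonical set partition π of type λ on S = {0,…,|λ|-1}:
-- the list of block labels of the elements of S (block j has λ_j elements)
blockLabels : List ℕ → List ℕ
blockLabels l = go 0 l
  where
  rep : ℕ → ℕ → List ℕ
  rep j zero = []
  rep j (suc k) = j ∷ rep j k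
  go : ℕ → List ℕ → List ℕ
  go j [] = []
  go j (x ∷ xs) = foldr _∷_ (go (suc j) xs) (rep j x)

cnt : (ℕ × ℕ → Bool) → List (ℕ × ℕ) → ℕ
cnt P [] = 0
cnt P (p ∷ ps) = if P p then suc (cnt P ps) else cnt P ps

module _ {c ℓ : Level} (R : CommutativeRing c ℓ) where
  open CommutativeRing R

  natR : ℕ → Carrier
  natR zero = 0#
  natR (suc n) = 1# + natR n

  sumR : List Carrier → Carrier
  sumR = foldr _+_ 0#

  prodR : List Carrier → Carrier
  prodR = foldr _*_ 1#

  QuasiGenus : Set c
  QuasiGenus = List ℕ → Carrier

  -- symmetric functions, given by their coefficients in the monomial
  -- basis m_μ (μ ranging over partitions)
  SymFun : Set c
  SymFun = List ℕ → Carrier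

  -- coefficient of m_μ (= coefficient of y_1^μ_1 ⋯ y_m^μ_m) in p_λ:
  -- sum over f : S → {1..m} with |f⁻¹(k)| = μ_k of ∏_k G_{type(π|f⁻¹(k))}
  -- (factors for empty fibres are G_∅ = 1 and are omitted)
  p : QuasiGenus → List ℕ → SymFun
  p G l μ = sumR (map term (colorings m (length labels)))
    where
    m = length μ
    labels = blockLabels l
    nb = length l
    fibresOk : List (ℕ × ℕ) → Bool
    fibresOk ps = and (zipWith (λ k μk → cnt (λ { (b , d) → d ≡ᵇ k }) ps ≡ᵇ μk) (upTo m) μ)
    typeAt : List (ℕ × ℕ) → ℕ → List ℕ
    typeAt ps k = normalize (map (λ j → cnt (λ { (b , d) → (b ≡ᵇ j) ∧ (d ≡ᵇ k) }) ps) (upTo nb))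
    term : List ℕ → Carrier
    term f = let ps = zip labels f in
      if fibresOk ps then prodR (map (λ k → G (typeAt ps k)) (upTo m)) else 0#

  -- D_n m_λ = n! m_{λ∖n}; in coefficients: (D_n F)_ν = n! F_{ν ∪ n}
  D : ℕ → SymFun → SymFun
  D n F ν = natR (n !) * F (insertDesc n ν)

  Full : QuasiGenus → Set ℓ
  Full G = (l : List ℕ) → IsPartition l →
      (¬ (p G l l ≈ 0#))
    × ((μ : List ℕ) → IsPartition μ → sum μ ≢ sum l → p G l μ ≈ 0#)
    × ((μ : List ℕ) → IsPartition μ → sum μ ≡ sum l → LexGt μ l → p G l μ ≈ 0#)

{-# OPTIONS --safe #-}
module Submission where

open import Defs
open import Level using (Level)
open import Algebra.Bundles using (CommutativeRing)
open import Data.List using (List; []; _∷_; map; zipWith; applyUpTo)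
open import Data.Nat using (ℕ; suc; _∸_; _≤_; _!)
open import Data.Nat.ListAction using (sum)
open import Data.Product using (_×_; _,_)
open import Relation.Nullary using (¬_)

-- Colour the blocks of π one at a time: a colouring f of S is a list of colourings of the blocks,
-- and its weight only depends on the matrix whose (j, k) entry counts the elements of block j of
-- colour k (its column sums are the fibre sizes, its columns the fibre types).  The coefficient of
-- m_ν in D_n p_λ is n! times that of m_{ν ∪ n} in p_λ; single out the colour class of size n.  If
-- it takes α_j elements of block j, there are ∏_j binom(λ_j, α_j) ways to place it (Pascal's rule,
-- colouring one element at a time), it contributes G_α, and the other colours colour a set
-- partition of type λ − α with fibre sizes ν, which is the coefficient of m_ν in p_{λ−α}.  For
-- n = 1 the vectors α are unit vectors, and grouping them by the part of λ they decrement gives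
-- the first formula.

module _ where
  open import Algebra.Bundles using (CommutativeMonoid)
  open import Data.Bool using (Bool; true; false; if_then_else_; _∧_; T)
  open import Data.Bool.ListAction using (and)
  open import Data.Bool.Properties using (∧-commutativeMonoid)
  open import Algebra.Properties.CommutativeSemigroup (CommutativeMonoid.commutativeSemigroup ∧-commutativeMonoid)
    using () renaming (x∙yz≈y∙xz to ∧-swap)
  open import Data.Empty using (⊥-elim)
  open import Data.List using (_++_; zip; concat; foldr; length; replicate; upTo)
  open import Data.List.Membership.Propositional using (_∈_)
  open import Data.List.Properties using (length-applyUpTo; length-++; length-replicate; length-map; map-upTo)
  import Data.List.Relation.Binary.Permutation.Propositional as ↭
  open ↭ using (_↭_; ↭-refl; ↭-trans; ↭-prep; ↭-swap)
  open import Data.List.Relation.Binary.Pointwise using (Pointwise; []; _∷_)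
  open import Data.List.Relation.Binary.Pointwise.Properties using (Pointwise-length)
  open import Data.List.Relation.Unary.All as All using (All; []; _∷_)
  open import Data.List.Relation.Unary.All.Properties using (++⁺; replicate⁺)
  open import Data.List.Relation.Unary.Any using (here; there)
  open import Data.Nat using (zero; _+_; _<_; z≤n; s≤s; _≡ᵇ_; _≤ᵇ_; pred)
  open import Data.Nat.Properties
    using (_≟_; _≤?_; _<?_; suc-injective; ≤-antisym; ≤-refl; <-irrefl; <-≤-trans; ≤-trans; n≤1+n; ≮⇒≥; ≰⇒>; <-asym; <⇒≱;
           ≤ᵇ⇒≤; ≤⇒≤ᵇ; +-suc; +-identityʳ; m≤m+n; m≤n+m)
  open import Data.Product using (Σ; proj₁; proj₂)
  open import Data.Unit using (tt)
  open import Relation.Binary.PropositionalEquality using (_≡_; _≢_; refl; sym; trans; cong; cong₂; subst; module ≡-Reasoning)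
  open import Relation.Nullary using (yes; no)
  open import Relation.Nullary.Decidable using (dec-true; dec-false)
  open ≡-Reasoning

  ≡ᵇ-refl : ∀ n → (n ≡ᵇ n) ≡ true
  ≡ᵇ-refl n = dec-true (n ≟ n) refl

  entry : ℕ → List ℕ → ℕ
  entry k [] = 0
  entry zero (x ∷ xs) = x
  entry (suc k) (x ∷ xs) = entry k xs

  insertAt : ∀ {a} {A : Set a} → ℕ → A → List A → List A
  insertAt zero x xs = x ∷ xs
  insertAt (suc i) x [] = x ∷ []
  insertAt (suc i) x (y ∷ ys) = y ∷ insertAt i x ys

  deleteAt : ℕ → List ℕ → List ℕ
  deleteAt i [] = []
  deleteAt zero (x ∷ xs) = xs
  deleteAt (suc i) (x ∷ xs) = x ∷ deleteAt i xs

  length-insertAt : ∀ {a} {A : Set a} i (x : A) xs → length (insertAt i x xs) ≡ suc (length xs)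
  length-insertAt zero x xs = refl
  length-insertAt (suc i) x [] = refl
  length-insertAt (suc i) x (y ∷ ys) = cong suc (length-insertAt i x ys)

  deleteAt-insertAt : ∀ i x xs → i ≤ length xs → deleteAt i (insertAt i x xs) ≡ xs
  deleteAt-insertAt zero x xs _ = refl
  deleteAt-insertAt (suc i) x (y ∷ ys) (s≤s i≤n) = cong (y ∷_) (deleteAt-insertAt i x ys i≤n)

  applyUpTo-cong : ∀ {a} {A : Set a} {f g : ℕ → A} n → (∀ k → f k ≡ g k) → applyUpTo f n ≡ applyUpTo g n
  applyUpTo-cong zero f≗g = refl
  applyUpTo-cong (suc n) f≗g = cong₂ _∷_ (f≗g 0) (applyUpTo-cong n (λ k → f≗g (suc k)))

  entry-applyUpTo : ∀ (g : ℕ → ℕ) m k → k < m → entry k (applyUpTo g m) ≡ g k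
  entry-applyUpTo g (suc m) zero _ = refl
  entry-applyUpTo g (suc m) (suc k) (s≤s k<m) = entry-applyUpTo (λ r → g (suc r)) m k k<m

  entry-applyUpTo-≥ : ∀ (g : ℕ → ℕ) m k → m ≤ k → entry k (applyUpTo g m) ≡ 0
  entry-applyUpTo-≥ g zero k _ = refl
  entry-applyUpTo-≥ g (suc m) (suc k) (s≤s m≤k) = entry-applyUpTo-≥ (λ r → g (suc r)) m k m≤k

  applyUpTo-entry : ∀ xs → applyUpTo (λ r → entry r xs) (length xs) ≡ xs
  applyUpTo-entry [] = refl
  applyUpTo-entry (x ∷ xs) = cong (x ∷_) (applyUpTo-entry xs)

  punchIn : ℕ → ℕ → ℕ
  punchIn zero k = suc k
  punchIn (suc i) zero = zero
  punchIn (suc i) (suc k) = suc (punchIn i k)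

  punchOut : ℕ → ℕ → ℕ
  punchOut zero x = pred x
  punchOut (suc i) zero = zero
  punchOut (suc i) (suc x) = suc (punchOut i x)

  punchIn-≢ : ∀ i k → punchIn i k ≢ i
  punchIn-≢ zero k ()
  punchIn-≢ (suc i) zero ()
  punchIn-≢ (suc i) (suc k) eq = punchIn-≢ i k (suc-injective eq)

  ≡ᵇ-punchIn : ∀ i k → (i ≡ᵇ punchIn i k) ≡ false
  ≡ᵇ-punchIn i k = dec-false (i ≟ punchIn i k) (λ eq → punchIn-≢ i k (sym eq))

  punchOut-punchIn : ∀ i k → punchOut i (punchIn i k) ≡ k
  punchOut-punchIn zero k = refl
  punchOut-punchIn (suc i) zero = refl
  punchOut-punchIn (suc i) (suc k) = cong suc (punchOut-punchIn i k)

  punchOut-≡ᵇ : ∀ i x k → x ≢ i → (punchOut i x ≡ᵇ k) ≡ (x ≡ᵇ punchIn i k)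
  punchOut-≡ᵇ zero zero k x≢i = ⊥-elim (x≢i refl)
  punchOut-≡ᵇ zero (suc x) k x≢i = refl
  punchOut-≡ᵇ (suc i) zero zero x≢i = refl
  punchOut-≡ᵇ (suc i) zero (suc k) x≢i = refl
  punchOut-≡ᵇ (suc i) (suc x) zero x≢i = refl
  punchOut-≡ᵇ (suc i) (suc x) (suc k) x≢i = punchOut-≡ᵇ i x k (λ eq → x≢i (cong suc eq))

  entry-deleteAt : ∀ i k xs → entry k (deleteAt i xs) ≡ entry (punchIn i k) xs
  entry-deleteAt i k [] = refl
  entry-deleteAt zero k (x ∷ xs) = refl
  entry-deleteAt (suc i) zero (x ∷ xs) = refl
  entry-deleteAt (suc i) (suc k) (x ∷ xs) = entry-deleteAt i k xs

  applyUpTo-punchIn : ∀ {a} {A : Set a} (g : ℕ → A) i m → i ≤ m →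
    applyUpTo g (suc m) ≡ insertAt i (g i) (applyUpTo (λ k → g (punchIn i k)) m)
  applyUpTo-punchIn g zero m _ = refl
  applyUpTo-punchIn g (suc i) (suc m) (s≤s i≤m) = cong (g 0 ∷_) (applyUpTo-punchIn (λ k → g (suc k)) i m i≤m)

  zipWith-insertAt : ∀ {A B C : Set} (f : A → B → C) i x y xs ys → length xs ≡ length ys →
    zipWith f (insertAt i x xs) (insertAt i y ys) ≡ insertAt i (f x y) (zipWith f xs ys)
  zipWith-insertAt f zero x y xs ys _ = refl
  zipWith-insertAt f (suc i) x y [] [] _ = refl
  zipWith-insertAt f (suc i) x y (a ∷ as) (b ∷ bs) eq = cong (f a b ∷_) (zipWith-insertAt f i x y as bs (suc-injective eq))

  and-insertAt : ∀ i b bs → and (insertAt i b bs) ≡ b ∧ and bs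
  and-insertAt zero b bs = refl
  and-insertAt (suc i) b [] = refl
  and-insertAt (suc i) b (c ∷ cs) = trans (cong (c ∧_) (and-insertAt i b cs)) (∧-swap c b (and cs))

  zipWith-applyUpTo : ∀ {B C : Set} (f : ℕ → B → C) (g h : ℕ → ℕ) m ys →
    zipWith f (applyUpTo (λ k → g (h k)) m) ys ≡ zipWith (λ k → f (g k)) (applyUpTo h m) ys
  zipWith-applyUpTo f g h zero ys = refl
  zipWith-applyUpTo f g h (suc m) [] = refl
  zipWith-applyUpTo f g h (suc m) (y ∷ ys) = cong (f (g (h 0)) y ∷_) (zipWith-applyUpTo f g (λ k → h (suc k)) m ys)

  and-zipWith-upTo-insertAt : ∀ (φ : ℕ → ℕ → Bool) i n ν → i ≤ length ν →
    and (zipWith φ (upTo (length (insertAt i n ν))) (insertAt i n ν))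
      ≡ φ i n ∧ and (zipWith (λ k → φ (punchIn i k)) (upTo (length ν)) ν)
  and-zipWith-upTo-insertAt φ i n ν i≤m = begin
    and (zipWith φ (upTo (length (insertAt i n ν))) (insertAt i n ν))
      ≡⟨ cong (λ ks → and (zipWith φ ks (insertAt i n ν)))
              (trans (cong upTo (length-insertAt i n ν)) (applyUpTo-punchIn (λ k → k) i m i≤m)) ⟩
    and (zipWith φ (insertAt i i (applyUpTo (punchIn i) m)) (insertAt i n ν))
      ≡⟨ cong and (zipWith-insertAt φ i i n _ ν (length-applyUpTo _ m)) ⟩
    and (insertAt i (φ i n) (zipWith φ (applyUpTo (punchIn i) m) ν))
      ≡⟨ and-insertAt i (φ i n) _ ⟩
    φ i n ∧ and (zipWith φ (applyUpTo (punchIn i) m) ν)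
      ≡⟨ cong (λ bs → φ i n ∧ and bs) (zipWith-applyUpTo φ (punchIn i) (λ k → k) m ν) ⟩
    φ i n ∧ and (zipWith (λ k → φ (punchIn i k)) (upTo m) ν) ∎
    where
    m : ℕ
    m = length ν

  zerosLike : List ℕ → List ℕ
  zerosLike = map (λ _ → 0)

  binomVec-zerosLike : ∀ l → binomVec l (zerosLike l) ≡ 1
  binomVec-zerosLike [] = refl
  binomVec-zerosLike (x ∷ l) = trans (+-identityʳ _) (binomVec-zerosLike l)

  dropZeros-zerosLike : ∀ l → dropZeros (zerosLike l) ≡ []
  dropZeros-zerosLike [] = refl
  dropZeros-zerosLike (x ∷ l) = dropZeros-zerosLike l

  zipWith-∸-zerosLike : ∀ l → zipWith _∸_ l (zerosLike l) ≡ l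
  zipWith-∸-zerosLike [] = refl
  zipWith-∸-zerosLike (x ∷ l) = cong (x ∷_) (zipWith-∸-zerosLike l)

  All-≤-sum : ∀ l → All (_≤ sum l) l
  All-≤-sum [] = []
  All-≤-sum (x ∷ l) = m≤m+n x (sum l) ∷ All.map (λ y≤ → ≤-trans y≤ (m≤n+m (sum l) x)) (All-≤-sum l)

  content : ℕ → List ℕ → List ℕ
  content m f = applyUpTo (λ k → mult k f) m

  IsColouring : ℕ → ℕ → List ℕ → Set
  IsColouring m a f = length f ≡ a × All (_< m) f

  deleteColour : ℕ → List ℕ → List ℕ
  deleteColour i [] = []
  deleteColour i (x ∷ xs) = if x ≡ᵇ i then deleteColour i xs else punchOut i x ∷ deleteColour i xs

  mult-deleteColour : ∀ i k f → mult k (deleteColour i f) ≡ mult (punchIn i k) f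
  mult-deleteColour i k [] = refl
  mult-deleteColour i k (x ∷ f) with x ≟ i
  ... | yes refl rewrite ≡ᵇ-refl x | ≡ᵇ-punchIn x k = mult-deleteColour x k f
  ... | no x≢i rewrite dec-false (x ≟ i) x≢i | punchOut-≡ᵇ i x k x≢i with x ≡ᵇ punchIn i k
  ...   | true = cong suc (mult-deleteColour i k f)
  ...   | false = mult-deleteColour i k f

  mult-∷-self : ∀ i f → mult i (i ∷ f) ≡ suc (mult i f)
  mult-∷-self i f rewrite ≡ᵇ-refl i = refl

  deleteColour-∷-self : ∀ i f → deleteColour i (i ∷ f) ≡ deleteColour i f
  deleteColour-∷-self i f rewrite ≡ᵇ-refl i = refl

  mult-∷-punchIn : ∀ i c f → mult i (punchIn i c ∷ f) ≡ mult i f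
  mult-∷-punchIn i c f rewrite dec-false (punchIn i c ≟ i) (punchIn-≢ i c) = refl

  deleteColour-∷-punchIn : ∀ i c f → deleteColour i (punchIn i c ∷ f) ≡ c ∷ deleteColour i f
  deleteColour-∷-punchIn i c f rewrite dec-false (punchIn i c ≟ i) (punchIn-≢ i c) | punchOut-punchIn i c = refl

  mult-≥ : ∀ {m} k f → m ≤ k → All (_< m) f → mult k f ≡ 0
  mult-≥ k [] _ [] = refl
  mult-≥ k (x ∷ f) m≤k (x<m ∷ f<m)
    rewrite dec-false (x ≟ k) (λ { refl → <-irrefl refl (<-≤-trans x<m m≤k) }) = mult-≥ k f m≤k f<m

  entry-content : ∀ m k f → All (_< m) f → entry k (content m f) ≡ mult k f
  entry-content m k f f<m with k <? m
  ... | yes k<m = entry-applyUpTo (λ r → mult r f) m k k<m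
  ... | no k≮m = trans (entry-applyUpTo-≥ (λ r → mult r f) m k (≮⇒≥ k≮m)) (sym (mult-≥ k f (≮⇒≥ k≮m) f<m))

  deleteAt-content : ∀ i m f → i ≤ m → deleteAt i (content (suc m) f) ≡ content m (deleteColour i f)
  deleteAt-content i m f i≤m = begin
    deleteAt i (content (suc m) f)
      ≡⟨ cong (deleteAt i) (applyUpTo-punchIn (λ k → mult k f) i m i≤m) ⟩
    deleteAt i (insertAt i (mult i f) (applyUpTo (λ k → mult (punchIn i k) f) m))
      ≡⟨ deleteAt-insertAt i _ _ (subst (i ≤_) (sym (length-applyUpTo _ m)) i≤m) ⟩
    applyUpTo (λ k → mult (punchIn i k) f) m
      ≡⟨ applyUpTo-cong m (λ k → sym (mult-deleteColour i k f)) ⟩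
    content m (deleteColour i f) ∎

  mult-++ : ∀ k f g → mult k (f ++ g) ≡ mult k f + mult k g
  mult-++ k [] g = refl
  mult-++ k (x ∷ f) g with x ≡ᵇ k
  ... | true = cong suc (mult-++ k f g)
  ... | false = mult-++ k f g

  mult-concat : ∀ k fs → mult k (concat fs) ≡ sum (map (mult k) fs)
  mult-concat k [] = refl
  mult-concat k (f ∷ fs) = trans (mult-++ k f (concat fs)) (cong (mult k f +_) (mult-concat k fs))

  length-concat : ∀ {l} {fs : List (List ℕ)} → Pointwise (λ a f → length f ≡ a) l fs → length (concat fs) ≡ sum l
  length-concat [] = refl
  length-concat {fs = f ∷ fs} (len ∷ ps) = trans (length-++ f) (cong₂ _+_ len (length-concat ps))

  column : ℕ → List (List ℕ) → List ℕ
  column k cs = map (entry k) cs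

  column-deleteAt : ∀ i k cs → column k (map (deleteAt i) cs) ≡ column (punchIn i k) cs
  column-deleteAt i k [] = refl
  column-deleteAt i k (c ∷ cs) = cong₂ _∷_ (entry-deleteAt i k c) (column-deleteAt i k cs)

  column-content : ∀ {m l fs} k → Pointwise (IsColouring m) l fs → column k (map (content m) fs) ≡ map (mult k) fs
  column-content k [] = refl
  column-content {m} k ((_ , f<m) ∷ ps) = cong₂ _∷_ (entry-content m k _ f<m) (column-content k ps)

  insertDesc-insertAt : ∀ n ν → Σ ℕ (λ i → i ≤ length ν × insertDesc n ν ≡ insertAt i n ν)
  insertDesc-insertAt n [] = 0 , z≤n , refl
  insertDesc-insertAt n (y ∷ ys) with y ≤ᵇ n
  ... | true = 0 , z≤n , refl
  ... | false with insertDesc-insertAt n ys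
  ...   | i , i≤n , eq = suc i , s≤s i≤n , cong (y ∷_) eq

  ≤ᵇ-true : ∀ m n → (m ≤ᵇ n) ≡ true → m ≤ n
  ≤ᵇ-true m n eq = ≤ᵇ⇒≤ m n (subst T (sym eq) tt)

  ≤ᵇ-false : ∀ m n → (m ≤ᵇ n) ≡ false → n < m
  ≤ᵇ-false m n eq = ≰⇒> (λ m≤n → subst T eq (≤⇒≤ᵇ m≤n))

  <⇒≤ᵇ-false : ∀ {m n} → n < m → (m ≤ᵇ n) ≡ false
  <⇒≤ᵇ-false {m} {n} n<m = dec-false (m ≤? n) (<⇒≱ n<m)

  insertDesc-front : ∀ x z zs → (z ≤ᵇ x) ≡ true → insertDesc x (z ∷ zs) ≡ x ∷ z ∷ zs
  insertDesc-front x z zs eq rewrite eq = refl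

  insertDesc-skip : ∀ x z zs → (z ≤ᵇ x) ≡ false → insertDesc x (z ∷ zs) ≡ z ∷ insertDesc x zs
  insertDesc-skip x z zs eq rewrite eq = refl

  insertDesc-comm-front : ∀ x y t → insertDesc x t ≡ x ∷ t → insertDesc y t ≡ y ∷ t →
    insertDesc x (y ∷ t) ≡ insertDesc y (x ∷ t)
  insertDesc-comm-front x y t x-front y-front with y ≤ᵇ x in y≤ᵇx | x ≤ᵇ y in x≤ᵇy
  ... | true | true = cong₂ (λ a b → a ∷ b ∷ t) x≡y (sym x≡y)
    where
    x≡y : x ≡ y
    x≡y = ≤-antisym (≤ᵇ-true x y x≤ᵇy) (≤ᵇ-true y x y≤ᵇx)
  ... | true | false = cong (x ∷_) (sym y-front)
  ... | false | true = cong (y ∷_) x-front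
  ... | false | false = ⊥-elim (<-asym (≤ᵇ-false y x y≤ᵇx) (≤ᵇ-false x y x≤ᵇy))

  insertDesc-comm : ∀ x y l → insertDesc x (insertDesc y l) ≡ insertDesc y (insertDesc x l)
  insertDesc-comm x y [] = insertDesc-comm-front x y [] refl refl
  insertDesc-comm x y (z ∷ zs) with z ≤ᵇ y in z≤ᵇy | z ≤ᵇ x in z≤ᵇx
  ... | true | true = insertDesc-comm-front x y (z ∷ zs) (insertDesc-front x z zs z≤ᵇx) (insertDesc-front y z zs z≤ᵇy)
  ... | true | false = begin
    insertDesc x (y ∷ z ∷ zs)     ≡⟨ insertDesc-skip x y _ (<⇒≤ᵇ-false (<-≤-trans (≤ᵇ-false z x z≤ᵇx) (≤ᵇ-true z y z≤ᵇy))) ⟩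
    y ∷ insertDesc x (z ∷ zs)     ≡⟨ cong (y ∷_) (insertDesc-skip x z zs z≤ᵇx) ⟩
    y ∷ z ∷ insertDesc x zs       ≡⟨ insertDesc-front y z _ z≤ᵇy ⟨
    insertDesc y (z ∷ insertDesc x zs) ∎
  ... | false | true = begin
    insertDesc x (z ∷ insertDesc y zs) ≡⟨ insertDesc-front x z _ z≤ᵇx ⟩
    x ∷ z ∷ insertDesc y zs       ≡⟨ cong (x ∷_) (insertDesc-skip y z zs z≤ᵇy) ⟨
    x ∷ insertDesc y (z ∷ zs)     ≡⟨ insertDesc-skip y x _ (<⇒≤ᵇ-false (<-≤-trans (≤ᵇ-false z y z≤ᵇy) (≤ᵇ-true z x z≤ᵇx))) ⟨
    insertDesc y (x ∷ z ∷ zs) ∎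
  ... | false | false = begin
    insertDesc x (z ∷ insertDesc y zs) ≡⟨ insertDesc-skip x z _ z≤ᵇx ⟩
    z ∷ insertDesc x (insertDesc y zs) ≡⟨ cong (z ∷_) (insertDesc-comm x y zs) ⟩
    z ∷ insertDesc y (insertDesc x zs) ≡⟨ insertDesc-skip y z _ z≤ᵇy ⟨
    insertDesc y (z ∷ insertDesc x zs) ∎

  insertDesc-↭ : ∀ x xs → insertDesc x xs ↭ x ∷ xs
  insertDesc-↭ x [] = ↭-refl
  insertDesc-↭ x (y ∷ ys) with y ≤ᵇ x
  ... | true = ↭-refl
  ... | false = ↭-trans (↭-prep y (insertDesc-↭ x ys)) (↭-swap y x ↭-refl)

  insertPositive : ℕ → List ℕ → List ℕ
  insertPositive zero l = l
  insertPositive (suc x) l = insertDesc (suc x) l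

  normalize-∷ : ∀ x xs → normalize (x ∷ xs) ≡ insertPositive x (normalize xs)
  normalize-∷ zero xs = refl
  normalize-∷ (suc x) xs = refl

  insertPositive-comm : ∀ x y l → insertPositive x (insertPositive y l) ≡ insertPositive y (insertPositive x l)
  insertPositive-comm zero y l = refl
  insertPositive-comm (suc x) zero l = refl
  insertPositive-comm (suc x) (suc y) l = insertDesc-comm (suc x) (suc y) l

  normalize-↭ : ∀ {xs ys} → xs ↭ ys → normalize xs ≡ normalize ys
  normalize-↭ ↭.refl = refl
  normalize-↭ (↭.prep {xs} {ys} x xs↭ys) = begin
    normalize (x ∷ xs)                ≡⟨ normalize-∷ x xs ⟩
    insertPositive x (normalize xs)   ≡⟨ cong (insertPositive x) (normalize-↭ xs↭ys) ⟩
    insertPositive x (normalize ys)   ≡⟨ normalize-∷ x ys ⟨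
    normalize (x ∷ ys)                ∎
  normalize-↭ (↭.swap {xs} {ys} x y xs↭ys) = begin
    normalize (x ∷ y ∷ xs)                               ≡⟨ normalize-∷ x (y ∷ xs) ⟩
    insertPositive x (normalize (y ∷ xs))                ≡⟨ cong (insertPositive x) (normalize-∷ y xs) ⟩
    insertPositive x (insertPositive y (normalize xs))   ≡⟨ insertPositive-comm x y _ ⟩
    insertPositive y (insertPositive x (normalize xs))   ≡⟨ cong (λ l → insertPositive y (insertPositive x l)) (normalize-↭ xs↭ys) ⟩
    insertPositive y (insertPositive x (normalize ys))   ≡⟨ cong (insertPositive y) (normalize-∷ x ys) ⟨
    insertPositive y (normalize (x ∷ ys))                ≡⟨ normalize-∷ y (x ∷ ys) ⟨
    normalize (y ∷ x ∷ ys)                               ∎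
  normalize-↭ (↭.trans p q) = trans (normalize-↭ p) (normalize-↭ q)

  normalize↭dropZeros : ∀ xs → normalize xs ↭ dropZeros xs
  normalize↭dropZeros [] = ↭-refl
  normalize↭dropZeros (zero ∷ xs) = normalize↭dropZeros xs
  normalize↭dropZeros (suc x ∷ xs) = ↭-trans (insertDesc-↭ (suc x) (normalize xs)) (↭-prep (suc x) (normalize↭dropZeros xs))

  normalize-1∷zerosLike : ∀ l → normalize (1 ∷ zerosLike l) ≡ 1 ∷ []
  normalize-1∷zerosLike l = cong (λ xs → insertDesc 1 (foldr insertDesc [] xs)) (dropZeros-zerosLike l)

  ∈⇒replaceFirst-↭ : ∀ {x} z B → x ∈ B → x ∷ replaceFirst x z B ↭ z ∷ B
  ∈⇒replaceFirst-↭ {x} z (b ∷ B) x∈B with b ≟ x | x∈B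
  ... | yes refl | _ rewrite ≡ᵇ-refl b = ↭-swap b z ↭-refl
  ... | no b≢x | here x≡b = ⊥-elim (b≢x (sym x≡b))
  ... | no b≢x | there x∈B′ rewrite dec-false (b ≟ x) b≢x =
    ↭-trans (↭-swap x b ↭-refl) (↭-trans (↭-prep b (∈⇒replaceFirst-↭ z B x∈B′)) (↭-swap b z ↭-refl))

  ∷-replaceFirst-↭ : ∀ {x} y z B → x ∈ B → y ∷ replaceFirst x z B ↭ replaceFirst x z (y ∷ B)
  ∷-replaceFirst-↭ {x} y z B x∈B with y ≟ x
  ... | no y≢x rewrite dec-false (y ≟ x) y≢x = ↭-refl
  ... | yes refl rewrite ≡ᵇ-refl y = ∈⇒replaceFirst-↭ z B x∈B

  labelsFrom : ℕ → List ℕ → List ℕ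
  labelsFrom j [] = []
  labelsFrom j (x ∷ xs) = replicate x j ++ labelsFrom (suc j) xs

  -- blockLabels is computed by where-bound helpers that cannot be named here; any T
  -- obeying their defining equations is determined, and unification supplies T.
  labels-unique : {T : ℕ → List ℕ → ℕ → ℕ → List ℕ} →
    (∀ j ys i k → T j ys i (suc k) ≡ i ∷ T j ys i k) →
    (∀ j i → T j [] i 0 ≡ []) →
    (∀ j y ys i → T j (y ∷ ys) i 0 ≡ T (suc j) ys j y) →
    ∀ j ys i k → T j ys i k ≡ replicate k i ++ labelsFrom j ys
  labels-unique T-suc T-[] T-∷ j ys i (suc k) = trans (T-suc j ys i k) (cong (i ∷_) (labels-unique T-suc T-[] T-∷ j ys i k))
  labels-unique T-suc T-[] T-∷ j [] i zero = T-[] j i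
  labels-unique T-suc T-[] T-∷ j (y ∷ ys) i zero = trans (T-∷ j y ys i) (labels-unique T-suc T-[] T-∷ (suc j) ys j y)

  blockLabels≡labelsFrom : ∀ l → blockLabels l ≡ labelsFrom 0 l
  blockLabels≡labelsFrom [] = refl
  blockLabels≡labelsFrom (x ∷ xs)
    with labels-unique (λ _ _ _ _ → refl) (λ _ _ → refl) (λ _ _ _ _ → refl) | 1 | xs | 0 | x
  ... | unique | j | ys | i | k = unique j ys i k

  length-labelsFrom : ∀ j l → length (labelsFrom j l) ≡ sum l
  length-labelsFrom j [] = refl
  length-labelsFrom j (x ∷ l) = begin
    length (replicate x j ++ labelsFrom (suc j) l)          ≡⟨ length-++ (replicate x j) ⟩
    length (replicate x j) + length (labelsFrom (suc j) l)  ≡⟨ cong₂ _+_ (length-replicate x) (length-labelsFrom (suc j) l) ⟩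
    x + sum l ∎

  labelsFrom-≥ : ∀ j l → All (j ≤_) (labelsFrom j l)
  labelsFrom-≥ j [] = []
  labelsFrom-≥ j (x ∷ l) = ++⁺ (replicate⁺ x ≤-refl) (All.map (≤-trans (n≤1+n j)) (labelsFrom-≥ (suc j) l))

  colourIs : ℕ → ℕ × ℕ → Bool
  colourIs k q = proj₂ q ≡ᵇ k

  labelColourIs : ℕ → ℕ → ℕ × ℕ → Bool
  labelColourIs j k q = (proj₁ q ≡ᵇ j) ∧ (proj₂ q ≡ᵇ k)

  cnt-++ : ∀ P xs ys → cnt P (xs ++ ys) ≡ cnt P xs + cnt P ys
  cnt-++ P [] ys = refl
  cnt-++ P (x ∷ xs) ys with P x
  ... | true = cong suc (cnt-++ P xs ys)
  ... | false = cnt-++ P xs ys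

  zip-++ : ∀ (A f B F : List ℕ) → length A ≡ length f → zip (A ++ B) (f ++ F) ≡ zip A f ++ zip B F
  zip-++ [] [] B F _ = refl
  zip-++ (a ∷ A) (x ∷ f) B F eq = cong ((a , x) ∷_) (zip-++ A f B F (suc-injective eq))

  cnt-colourIs : ∀ k L f → length L ≡ length f → cnt (colourIs k) (zip L f) ≡ mult k f
  cnt-colourIs k [] [] _ = refl
  cnt-colourIs k (b ∷ L) (x ∷ f) eq with x ≡ᵇ k
  ... | true = cong suc (cnt-colourIs k L f (suc-injective eq))
  ... | false = cnt-colourIs k L f (suc-injective eq)

  cnt-labelColourIs-replicate : ∀ j k f → cnt (labelColourIs j k) (zip (replicate (length f) j) f) ≡ mult k f
  cnt-labelColourIs-replicate j k [] = refl
  cnt-labelColourIs-replicate j k (x ∷ f) rewrite ≡ᵇ-refl j with x ≡ᵇ k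
  ... | true = cong suc (cnt-labelColourIs-replicate j k f)
  ... | false = cnt-labelColourIs-replicate j k f

  cnt-labelColourIs-absent : ∀ j k L f → All (_≢ j) L → cnt (labelColourIs j k) (zip L f) ≡ 0
  cnt-labelColourIs-absent j k [] f _ = refl
  cnt-labelColourIs-absent j k (b ∷ L) [] _ = refl
  cnt-labelColourIs-absent j k (b ∷ L) (x ∷ f) (b≢j ∷ L≢j) rewrite dec-false (b ≟ j) b≢j = cnt-labelColourIs-absent j k L f L≢j

  module _ (k : ℕ) where

    cnt-labelColourIs-split : ∀ i j f L F →
      cnt (labelColourIs i k) (zip (replicate (length f) j ++ L) (f ++ F))
        ≡ cnt (labelColourIs i k) (zip (replicate (length f) j) f) + cnt (labelColourIs i k) (zip L F)
    cnt-labelColourIs-split i j f L F =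
      trans (cong (cnt (labelColourIs i k)) (zip-++ (replicate (length f) j) f L F (length-replicate (length f))))
            (cnt-++ (labelColourIs i k) (zip (replicate (length f) j) f) (zip L F))

    cnt-labelsFrom : ∀ {l fs} → Pointwise (λ a f → length f ≡ a) l fs → ∀ j r →
      cnt (labelColourIs (j + r) k) (zip (labelsFrom j l) (concat fs)) ≡ entry r (map (mult k) fs)
    cnt-labelsFrom [] j r = refl
    cnt-labelsFrom {_ ∷ l} {f ∷ fs} (refl ∷ ps) j zero rewrite +-identityʳ j = begin
      cnt (labelColourIs j k) (zip (replicate (length f) j ++ labelsFrom (suc j) l) (f ++ concat fs))
        ≡⟨ cnt-labelColourIs-split j j f (labelsFrom (suc j) l) (concat fs) ⟩
      cnt (labelColourIs j k) (zip (replicate (length f) j) f) + cnt (labelColourIs j k) (zip (labelsFrom (suc j) l) (concat fs))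
        ≡⟨ cong₂ _+_ (cnt-labelColourIs-replicate j k f)
                     (cnt-labelColourIs-absent j k (labelsFrom (suc j) l) (concat fs)
                       (All.map (λ j<b b≡j → <-irrefl (sym b≡j) j<b) (labelsFrom-≥ (suc j) l))) ⟩
      mult k f + 0
        ≡⟨ +-identityʳ (mult k f) ⟩
      mult k f ∎
    cnt-labelsFrom {_ ∷ l} {f ∷ fs} (refl ∷ ps) j (suc r) rewrite +-suc j r = begin
      cnt (labelColourIs (suc j + r) k) (zip (replicate (length f) j ++ labelsFrom (suc j) l) (f ++ concat fs))
        ≡⟨ cnt-labelColourIs-split (suc j + r) j f (labelsFrom (suc j) l) (concat fs) ⟩
      cnt (labelColourIs (suc j + r) k) (zip (replicate (length f) j) f) + cnt (labelColourIs (suc j + r) k) (zip (labelsFrom (suc j) l) (concat fs))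
        ≡⟨ cong₂ _+_ (cnt-labelColourIs-absent (suc j + r) k (replicate (length f) j) f
                       (replicate⁺ (length f) (λ j≡ → <-irrefl j≡ (s≤s (m≤m+n j r)))))
                     (cnt-labelsFrom ps (suc j) r) ⟩
      entry r (map (mult k) fs) ∎

  labelColumn : ∀ {l} {fs : List (List ℕ)} k → Pointwise (λ a f → length f ≡ a) l fs →
    map (λ j → cnt (labelColourIs j k) (zip (labelsFrom 0 l) (concat fs))) (upTo (length l)) ≡ map (mult k) fs
  labelColumn {l} {fs} k ps = begin
    map (λ j → cnt (labelColourIs j k) (zip (labelsFrom 0 l) (concat fs))) (upTo (length l))
      ≡⟨ map-upTo _ (length l) ⟩
    applyUpTo (λ j → cnt (labelColourIs j k) (zip (labelsFrom 0 l) (concat fs))) (length l)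
      ≡⟨ applyUpTo-cong (length l) (cnt-labelsFrom k ps 0) ⟩
    applyUpTo (λ r → entry r (map (mult k) fs)) (length l)
      ≡⟨ cong (applyUpTo _) (trans (Pointwise-length ps) (sym (length-map (mult k) fs))) ⟩
    applyUpTo (λ r → entry r (map (mult k) fs)) (length (map (mult k) fs))
      ≡⟨ applyUpTo-entry (map (mult k) fs) ⟩
    map (mult k) fs ∎

module _ {c ℓ : Level} (R : CommutativeRing c ℓ) where
  import Algebra.Properties.CommutativeSemigroup as CommSemigroupProperties
  open import Data.Bool using (true; false; if_then_else_; _∧_)
  open import Data.Bool.ListAction using (and)
  open import Data.List using (_++_; filter; zip; concat; concatMap; upTo; length)
  open import Data.List.Membership.Propositional using (_∈_)
  open import Data.List.Membership.Propositional.Properties using (∈-upTo⁻)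
  open import Data.List.Properties using (map-upTo; upTo-∷ʳ; map-cong; zipWith-cong)
  import Data.List.Relation.Binary.Permutation.Propositional as ↭
  open ↭ using (_↭_)
  import Data.List.Relation.Binary.Permutation.Propositional.Properties as ↭
  open import Data.List.Relation.Binary.Pointwise as Pointwise using (Pointwise; []; _∷_)
  open import Data.List.Relation.Unary.All as All using (All; []; _∷_)
  open import Data.List.Relation.Unary.Any using (here; there)
  open import Data.Nat as ℕ using (zero; _<_; s≤s; _≡ᵇ_)
  open import Data.Nat.Combinatorics using (_C_; nC1≡n; nCk+nC[k+1]≡[n+1]C[k+1])
  open import Data.Nat.Combinatorics.Specification using (k>n⇒nCk≡0)
  open import Data.Nat.ListAction.Properties using (sum-↭)
  open import Data.Nat.Properties as ℕ using (_≟_; n<1+n; +-∸-assoc)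
  open import Data.Product using (proj₁)
  open import Relation.Binary.PropositionalEquality as ≡ using (_≡_)
  open import Relation.Nullary using (does)
  open import Relation.Nullary.Decidable using (dec-false)
  open import Relation.Unary using (Decidable)
  open CommutativeRing R
  open import Relation.Binary.Reasoning.Setoid setoid
  open CommSemigroupProperties +-commutativeSemigroup using (interchange; x∙yz≈y∙xz)
  open CommSemigroupProperties *-commutativeSemigroup using () renaming (x∙yz≈y∙xz to x*yz≈y*xz)

  ∑ : {A : Set} → List A → (A → Carrier) → Carrier
  ∑ xs f = sumR R (map f xs)

  syntax ∑ xs (λ x → e) = ∑[ x ← xs ] e

  ∑-cong : ∀ {A : Set} (xs : List A) {f g : A → Carrier} → (∀ x → f x ≈ g x) → ∑ xs f ≈ ∑ xs g
  ∑-cong [] f≈g = refl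
  ∑-cong (x ∷ xs) f≈g = +-cong (f≈g x) (∑-cong xs f≈g)

  ∑-cong-∈ : ∀ {A : Set} (xs : List A) {f g : A → Carrier} → (∀ {x} → x ∈ xs → f x ≈ g x) → ∑ xs f ≈ ∑ xs g
  ∑-cong-∈ [] f≈g = refl
  ∑-cong-∈ (x ∷ xs) f≈g = +-cong (f≈g (here ≡.refl)) (∑-cong-∈ xs (λ x∈xs → f≈g (there x∈xs)))

  ∑-zero : ∀ {A : Set} (xs : List A) {f : A → Carrier} → (∀ x → f x ≈ 0#) → ∑ xs f ≈ 0#
  ∑-zero [] f≈0 = refl
  ∑-zero (x ∷ xs) f≈0 = trans (+-cong (f≈0 x) (∑-zero xs f≈0)) (+-identityʳ 0#)

  ∑-++ : ∀ {A : Set} (xs ys : List A) (f : A → Carrier) → ∑ (xs ++ ys) f ≈ ∑ xs f + ∑ ys f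
  ∑-++ [] ys f = sym (+-identityˡ _)
  ∑-++ (x ∷ xs) ys f = trans (+-congˡ (∑-++ xs ys f)) (sym (+-assoc _ _ _))

  ∑-map : ∀ {A B : Set} (g : A → B) (xs : List A) (f : B → Carrier) → ∑ (map g xs) f ≈ ∑[ x ← xs ] f (g x)
  ∑-map g [] f = refl
  ∑-map g (x ∷ xs) f = +-congˡ (∑-map g xs f)

  ∑-concatMap : ∀ {A B : Set} (g : A → List B) (xs : List A) (f : B → Carrier) →
    ∑ (concatMap g xs) f ≈ ∑[ x ← xs ] ∑ (g x) f
  ∑-concatMap g [] f = refl
  ∑-concatMap g (x ∷ xs) f = trans (∑-++ (g x) (concatMap g xs) f) (+-congˡ (∑-concatMap g xs f))

  ∑-+ : ∀ {A : Set} (xs : List A) (f g : A → Carrier) → ∑[ x ← xs ] (f x + g x) ≈ ∑ xs f + ∑ xs g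
  ∑-+ [] f g = sym (+-identityˡ 0#)
  ∑-+ (x ∷ xs) f g = trans (+-congˡ (∑-+ xs f g)) (interchange _ _ _ _)

  ∑-*ˡ : ∀ {A : Set} (xs : List A) (a : Carrier) (f : A → Carrier) → ∑[ x ← xs ] (a * f x) ≈ a * ∑ xs f
  ∑-*ˡ [] a f = sym (zeroʳ a)
  ∑-*ˡ (x ∷ xs) a f = trans (+-congˡ (∑-*ˡ xs a f)) (sym (distribˡ a _ _))

  ∑-comm : ∀ {A B : Set} (xs : List A) (ys : List B) (f : A → B → Carrier) →
    ∑[ x ← xs ] ∑[ y ← ys ] f x y ≈ ∑[ y ← ys ] ∑[ x ← xs ] f x y
  ∑-comm [] ys f = sym (∑-zero ys (λ _ → refl))
  ∑-comm (x ∷ xs) ys f = trans (+-congˡ (∑-comm xs ys f)) (sym (∑-+ ys (f x) _))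

  ∑-insertAt : ∀ {A : Set} i (x : A) xs (f : A → Carrier) → ∑ (insertAt i x xs) f ≈ f x + ∑ xs f
  ∑-insertAt zero x xs f = refl
  ∑-insertAt (suc i) x [] f = refl
  ∑-insertAt (suc i) x (y ∷ ys) f = trans (+-congˡ (∑-insertAt i x ys f)) (x∙yz≈y∙xz (f y) (f x) _)

  ∑-applyUpTo : ∀ (g : ℕ → ℕ) n (f : ℕ → Carrier) → ∑ (applyUpTo g n) f ≈ ∑[ k ← upTo n ] f (g k)
  ∑-applyUpTo g n f = trans (reflexive (≡.cong (λ ks → ∑ ks f) (≡.sym (map-upTo g n)))) (∑-map g (upTo n) f)

  ∑-upTo-punchIn : ∀ i m → i ≤ m → (f : ℕ → Carrier) →
    ∑ (upTo (suc m)) f ≈ f i + ∑[ k ← upTo m ] f (punchIn i k)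
  ∑-upTo-punchIn i m i≤m f = begin
    ∑ (upTo (suc m)) f                                        ≡⟨ ≡.cong (λ ks → ∑ ks f) (applyUpTo-punchIn (λ k → k) i m i≤m) ⟩
    ∑ (insertAt i i (applyUpTo (punchIn i) m)) f              ≈⟨ ∑-insertAt i i _ f ⟩
    f i + ∑ (applyUpTo (punchIn i) m) f                       ≈⟨ +-congˡ (∑-applyUpTo (punchIn i) m f) ⟩
    f i + ∑[ k ← upTo m ] f (punchIn i k)                     ∎

  ∑-upTo-suc : ∀ n (f : ℕ → Carrier) → ∑ (upTo (suc n)) f ≈ f 0 + ∑[ t ← upTo n ] f (suc t)
  ∑-upTo-suc n f = +-congˡ (∑-applyUpTo suc n f)

  ∑-upTo-sucʳ : ∀ n (f : ℕ → Carrier) → ∑ (upTo (suc n)) f ≈ ∑ (upTo n) f + f n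
  ∑-upTo-sucʳ n f = begin
    ∑ (upTo (suc n)) f         ≡⟨ ≡.cong (λ ks → ∑ ks f) (upTo-∷ʳ n) ⟨
    ∑ (upTo n ++ n ∷ []) f     ≈⟨ ∑-++ (upTo n) (n ∷ []) f ⟩
    ∑ (upTo n) f + (f n + 0#)  ≈⟨ +-congˡ (+-identityʳ (f n)) ⟩
    ∑ (upTo n) f + f n         ∎

  ∑-upTo-indicator : ∀ {x N} → x < N → (f : ℕ → Carrier) → ∑[ t ← upTo N ] (if x ≡ᵇ t then f t else 0#) ≈ f x
  ∑-upTo-indicator {x} {suc M} (s≤s x≤M) f = begin
    ∑[ t ← upTo (suc M) ] (if x ≡ᵇ t then f t else 0#)
      ≈⟨ ∑-upTo-punchIn x M x≤M _ ⟩
    (if x ≡ᵇ x then f x else 0#) + ∑[ k ← upTo M ] (if x ≡ᵇ punchIn x k then f (punchIn x k) else 0#)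
      ≈⟨ +-cong (reflexive (≡.cong (λ b → if b then f x else 0#) (≡ᵇ-refl x)))
                (∑-zero (upTo M) (λ k → reflexive (≡.cong (λ b → if b then f (punchIn x k) else 0#) (≡ᵇ-punchIn x k)))) ⟩
    f x + 0#
      ≈⟨ +-identityʳ (f x) ⟩
    f x ∎

  ∑-filter : ∀ {A : Set} {P : A → Set} (P? : Decidable P) xs (F : A → Carrier) →
    ∑ (filter P? xs) F ≈ ∑[ x ← xs ] (if does (P? x) then F x else 0#)
  ∑-filter P? [] F = refl
  ∑-filter P? (x ∷ xs) F with does (P? x)
  ... | true = +-congˡ (∑-filter P? xs F)
  ... | false = trans (∑-filter P? xs F) (sym (+-identityˡ _))

  natR-+ : ∀ m n → natR R (m ℕ.+ n) ≈ natR R m + natR R n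
  natR-+ zero n = sym (+-identityˡ _)
  natR-+ (suc m) n = trans (+-congˡ (natR-+ m n)) (sym (+-assoc _ _ _))

  natR-* : ∀ m n → natR R (m ℕ.* n) ≈ natR R m * natR R n
  natR-* zero n = sym (zeroˡ _)
  natR-* (suc m) n = begin
    natR R (n ℕ.+ m ℕ.* n)                    ≈⟨ natR-+ n (m ℕ.* n) ⟩
    natR R n + natR R (m ℕ.* n)               ≈⟨ +-cong (sym (*-identityˡ _)) (natR-* m n) ⟩
    1# * natR R n + natR R m * natR R n       ≈⟨ distribʳ _ _ _ ⟨
    (1# + natR R m) * natR R n                ∎

  natR-1-* : ∀ x → natR R 1 * x ≈ x
  natR-1-* x = trans (*-congʳ (+-identityʳ 1#)) (*-identityˡ x)

  prodR-insertAt : ∀ i x xs → prodR R (insertAt i x xs) ≈ x * prodR R xs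
  prodR-insertAt zero x xs = refl
  prodR-insertAt (suc i) x [] = refl
  prodR-insertAt (suc i) x (y ∷ ys) = trans (*-congˡ (prodR-insertAt i x ys)) (x*yz≈y*xz y x _)

  prodR-upTo-punchIn : ∀ i m → i ≤ m → (ψ : ℕ → Carrier) →
    prodR R (map ψ (upTo (suc m))) ≈ ψ i * prodR R (map (λ k → ψ (punchIn i k)) (upTo m))
  prodR-upTo-punchIn i m i≤m ψ = begin
    prodR R (map ψ (upTo (suc m)))                               ≡⟨ ≡.cong (prodR R) (map-upTo ψ (suc m)) ⟩
    prodR R (applyUpTo ψ (suc m))                                ≡⟨ ≡.cong (prodR R) (applyUpTo-punchIn ψ i m i≤m) ⟩
    prodR R (insertAt i (ψ i) (applyUpTo (λ k → ψ (punchIn i k)) m)) ≈⟨ prodR-insertAt i (ψ i) _ ⟩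
    ψ i * prodR R (applyUpTo (λ k → ψ (punchIn i k)) m)          ≡⟨ ≡.cong (λ xs → ψ i * prodR R xs) (map-upTo _ m) ⟨
    ψ i * prodR R (map (λ k → ψ (punchIn i k)) (upTo m))         ∎

  if-∧-* : ∀ b₁ b₂ {x y z} → z ≈ x * y → (if b₁ ∧ b₂ then z else 0#) ≈ (if b₁ then x else 0#) * (if b₂ then y else 0#)
  if-∧-* true true z≈xy = z≈xy
  if-∧-* true false {x} z≈xy = sym (zeroʳ x)
  if-∧-* false b₂ z≈xy = sym (zeroˡ _)

  *-if-* : ∀ x b {y z : Carrier} → x * ((if b then y else 0#) * z) ≈ (if b then x * y * z else 0#)
  *-if-* x true = sym (*-assoc _ _ _)
  *-if-* x false = trans (*-congˡ (zeroˡ _)) (zeroʳ x)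

  binomialSum : ℕ → (ℕ → ℕ → Carrier) → Carrier
  binomialSum a F = ∑[ t ← upTo (suc a) ] (natR R (a C t) * F t (a ∸ t))

  binomialSum-shiftʳ : ∀ a (F : ℕ → ℕ → Carrier) →
    binomialSum a (λ t r → F t (suc r))
      ≈ F 0 (suc a) + ∑[ t ← upTo (suc a) ] (natR R (a C suc t) * F (suc t) (a ∸ t))
  binomialSum-shiftʳ a F = begin
    binomialSum a (λ t r → F t (suc r))
      ≈⟨ ∑-upTo-suc a _ ⟩
    natR R 1 * F 0 (suc a) + ∑[ t ← upTo a ] (natR R (a C suc t) * F (suc t) (suc (a ∸ suc t)))
      ≈⟨ +-cong (natR-1-* _)
                (∑-cong-∈ (upTo a) (λ {t} t∈ →
                  reflexive (≡.cong (λ r → natR R (a C suc t) * F (suc t) r) (≡.sym (+-∸-assoc 1 (∈-upTo⁻ t∈)))))) ⟩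
    F 0 (suc a) + ∑[ t ← upTo a ] (natR R (a C suc t) * F (suc t) (a ∸ t))
      ≈⟨ +-congˡ (sym (+-identityʳ _)) ⟩
    F 0 (suc a) + (∑[ t ← upTo a ] (natR R (a C suc t) * F (suc t) (a ∸ t)) + 0#)
      ≈⟨ +-congˡ (+-congˡ (sym (trans (*-congʳ (reflexive (≡.cong (natR R) (k>n⇒nCk≡0 (n<1+n a))))) (zeroˡ _)))) ⟩
    F 0 (suc a) + (∑[ t ← upTo a ] (natR R (a C suc t) * F (suc t) (a ∸ t)) + natR R (a C suc a) * F (suc a) (a ∸ a))
      ≈⟨ +-congˡ (∑-upTo-sucʳ a _) ⟨
    F 0 (suc a) + ∑[ t ← upTo (suc a) ] (natR R (a C suc t) * F (suc t) (a ∸ t)) ∎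

  binomialSum-pascal : ∀ a (F : ℕ → ℕ → Carrier) →
    binomialSum (suc a) F ≈ binomialSum a (λ t r → F (suc t) r) + binomialSum a (λ t r → F t (suc r))
  binomialSum-pascal a F = begin
    binomialSum (suc a) F
      ≈⟨ ∑-upTo-suc (suc a) _ ⟩
    natR R 1 * F 0 (suc a) + ∑[ t ← upTo (suc a) ] (natR R (suc a C suc t) * F (suc t) (a ∸ t))
      ≈⟨ +-cong (natR-1-* _) (∑-cong (upTo (suc a)) pascal) ⟩
    F 0 (suc a) + ∑[ t ← upTo (suc a) ] (natR R (a C t) * F (suc t) (a ∸ t) + natR R (a C suc t) * F (suc t) (a ∸ t))
      ≈⟨ +-congˡ (∑-+ (upTo (suc a)) _ _) ⟩
    F 0 (suc a) + (binomialSum a (λ t r → F (suc t) r) + ∑[ t ← upTo (suc a) ] (natR R (a C suc t) * F (suc t) (a ∸ t)))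
      ≈⟨ x∙yz≈y∙xz _ _ _ ⟩
    binomialSum a (λ t r → F (suc t) r) + (F 0 (suc a) + ∑[ t ← upTo (suc a) ] (natR R (a C suc t) * F (suc t) (a ∸ t)))
      ≈⟨ +-congˡ (binomialSum-shiftʳ a F) ⟨
    binomialSum a (λ t r → F (suc t) r) + binomialSum a (λ t r → F t (suc r)) ∎
    where
    pascal : ∀ t → natR R (suc a C suc t) * F (suc t) (a ∸ t)
                     ≈ natR R (a C t) * F (suc t) (a ∸ t) + natR R (a C suc t) * F (suc t) (a ∸ t)
    pascal t = begin
      natR R (suc a C suc t) * F (suc t) (a ∸ t)                  ≡⟨ ≡.cong (λ n → natR R n * F (suc t) (a ∸ t)) (nCk+nC[k+1]≡[n+1]C[k+1] a t) ⟨
      natR R (a C t ℕ.+ a C suc t) * F (suc t) (a ∸ t)             ≈⟨ *-congʳ (natR-+ (a C t) (a C suc t)) ⟩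
      (natR R (a C t) + natR R (a C suc t)) * F (suc t) (a ∸ t)    ≈⟨ distribʳ _ _ _ ⟩
      natR R (a C t) * F (suc t) (a ∸ t) + natR R (a C suc t) * F (suc t) (a ∸ t) ∎

  binomialSum-cong : ∀ a {F G : ℕ → ℕ → Carrier} → (∀ t r → F t r ≈ G t r) → binomialSum a F ≈ binomialSum a G
  binomialSum-cong a F≈G = ∑-cong (upTo (suc a)) (λ t → *-congˡ (F≈G t (a ∸ t)))

  ∑-binomialSum : ∀ {A : Set} (xs : List A) a (F : A → ℕ → ℕ → Carrier) →
    ∑[ x ← xs ] binomialSum a (F x) ≈ binomialSum a (λ t r → ∑[ x ← xs ] F x t r)
  ∑-binomialSum xs a F = trans (∑-comm xs (upTo (suc a)) _) (∑-cong (upTo (suc a)) (λ t → ∑-*ˡ xs _ _))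

  ∑-colorings-suc : ∀ m a (h : List ℕ → Carrier) →
    ∑ (colorings m (suc a)) h ≈ ∑[ c ← upTo m ] ∑[ f ← colorings m a ] h (c ∷ f)
  ∑-colorings-suc m a h = trans (∑-concatMap _ (upTo m) h) (∑-cong (upTo m) (λ c → ∑-map (c ∷_) (colorings m a) h))

  ∑-colorings-cong : ∀ m a {g h : List ℕ → Carrier} → (∀ f → IsColouring m a f → g f ≈ h f) →
    ∑ (colorings m a) g ≈ ∑ (colorings m a) h
  ∑-colorings-cong m zero g≈h = +-congʳ (g≈h [] (≡.refl , []))
  ∑-colorings-cong m (suc a) {g} {h} g≈h = begin
    ∑ (colorings m (suc a)) g
      ≈⟨ ∑-colorings-suc m a g ⟩
    ∑[ c ← upTo m ] ∑[ f ← colorings m a ] g (c ∷ f)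
      ≈⟨ ∑-cong-∈ (upTo m) (λ c∈ → ∑-colorings-cong m a (λ f (len , f<m) → g≈h (_ ∷ f) (≡.cong suc len , ∈-upTo⁻ c∈ ∷ f<m))) ⟩
    ∑[ c ← upTo m ] ∑[ f ← colorings m a ] h (c ∷ f)
      ≈⟨ ∑-colorings-suc m a h ⟨
    ∑ (colorings m (suc a)) h ∎

  ∑-colorings-+ : ∀ m a b (h : List ℕ → Carrier) →
    ∑ (colorings m (a ℕ.+ b)) h ≈ ∑[ f ← colorings m a ] ∑[ g ← colorings m b ] h (f ++ g)
  ∑-colorings-+ m zero b h = sym (+-identityʳ _)
  ∑-colorings-+ m (suc a) b h = begin
    ∑ (colorings m (suc a ℕ.+ b)) h
      ≈⟨ ∑-colorings-suc m (a ℕ.+ b) h ⟩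
    ∑[ c ← upTo m ] ∑ (colorings m (a ℕ.+ b)) (λ f → h (c ∷ f))
      ≈⟨ ∑-cong (upTo m) (λ c → ∑-colorings-+ m a b (λ f → h (c ∷ f))) ⟩
    ∑[ c ← upTo m ] ∑[ f ← colorings m a ] ∑[ g ← colorings m b ] h (c ∷ f ++ g)
      ≈⟨ ∑-colorings-suc m a _ ⟨
    ∑[ f ← colorings m (suc a) ] ∑[ g ← colorings m b ] h (f ++ g) ∎

  ∑-colorings-splitColour : ∀ m i → i ≤ m → ∀ a (h : ℕ → List ℕ → Carrier) →
    ∑[ f ← colorings (suc m) a ] h (mult i f) (deleteColour i f)
      ≈ binomialSum a (λ t r → ∑[ g ← colorings m r ] h t g)
  ∑-colorings-splitColour m i i≤m zero h = sym (trans (+-congʳ (natR-1-* _)) (+-identityʳ _))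
  ∑-colorings-splitColour m i i≤m (suc a) h = begin
    ∑[ f ← colorings (suc m) (suc a) ] h (mult i f) (deleteColour i f)
      ≈⟨ ∑-colorings-suc (suc m) a _ ⟩
    ∑[ c ← upTo (suc m) ] ∑[ f ← colorings (suc m) a ] h (mult i (c ∷ f)) (deleteColour i (c ∷ f))
      ≈⟨ ∑-upTo-punchIn i m i≤m _ ⟩
    ∑[ f ← colorings (suc m) a ] h (mult i (i ∷ f)) (deleteColour i (i ∷ f))
      + ∑[ c ← upTo m ] ∑[ f ← colorings (suc m) a ] h (mult i (punchIn i c ∷ f)) (deleteColour i (punchIn i c ∷ f))
      ≈⟨ +-cong (∑-cong (colorings (suc m) a) (λ f → reflexive (≡.cong₂ h (mult-∷-self i f) (deleteColour-∷-self i f))))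
                (∑-cong (upTo m) (λ c → ∑-cong (colorings (suc m) a) (λ f →
                  reflexive (≡.cong₂ h (mult-∷-punchIn i c f) (deleteColour-∷-punchIn i c f))))) ⟩
    ∑[ f ← colorings (suc m) a ] h (suc (mult i f)) (deleteColour i f)
      + ∑[ c ← upTo m ] ∑[ f ← colorings (suc m) a ] h (mult i f) (c ∷ deleteColour i f)
      ≈⟨ +-cong (∑-colorings-splitColour m i i≤m a (λ t → h (suc t)))
                (∑-cong (upTo m) (λ c → ∑-colorings-splitColour m i i≤m a (λ t g → h t (c ∷ g)))) ⟩
    binomialSum a (λ t r → ∑[ g ← colorings m r ] h (suc t) g)
      + ∑[ c ← upTo m ] binomialSum a (λ t r → ∑[ g ← colorings m r ] h t (c ∷ g))
      ≈⟨ +-congˡ (∑-binomialSum (upTo m) a (λ c t r → ∑[ g ← colorings m r ] h t (c ∷ g))) ⟩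
    binomialSum a (λ t r → ∑[ g ← colorings m r ] h (suc t) g)
      + binomialSum a (λ t r → ∑[ c ← upTo m ] ∑[ g ← colorings m r ] h t (c ∷ g))
      ≈⟨ +-congˡ (binomialSum-cong a (λ t r → ∑-colorings-suc m r (h t))) ⟨
    binomialSum a (λ t r → ∑[ g ← colorings m r ] h (suc t) g)
      + binomialSum a (λ t r → ∑[ g ← colorings m (suc r) ] h t g)
      ≈⟨ binomialSum-pascal a (λ t r → ∑[ g ← colorings m r ] h t g) ⟨
    binomialSum (suc a) (λ t r → ∑[ g ← colorings m r ] h t g) ∎

  -- H sees the matrix whose j-th row counts the colours used on block j.
  blockSum : ℕ → List ℕ → (List (List ℕ) → Carrier) → Carrier
  blockSum m [] H = H []
  blockSum m (a ∷ l) H = ∑[ f ← colorings m a ] blockSum m l (λ cs → H (content m f ∷ cs))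

  blockSum-cong : ∀ m l {H H′ : List (List ℕ) → Carrier} → (∀ cs → H cs ≈ H′ cs) → blockSum m l H ≈ blockSum m l H′
  blockSum-cong m [] H≈H′ = H≈H′ []
  blockSum-cong m (a ∷ l) H≈H′ = ∑-cong (colorings m a) (λ f → blockSum-cong m l (λ cs → H≈H′ (content m f ∷ cs)))

  blockSum-*ˡ : ∀ m l x (H : List (List ℕ) → Carrier) → blockSum m l (λ cs → x * H cs) ≈ x * blockSum m l H
  blockSum-*ˡ m [] x H = refl
  blockSum-*ˡ m (a ∷ l) x H = trans (∑-cong (colorings m a) (λ f → blockSum-*ˡ m l x _)) (∑-*ˡ (colorings m a) x _)

  ∑-colorings-blockwise : ∀ m l (h : List ℕ → Carrier) (H : List (List ℕ) → Carrier) →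
    (∀ fs → Pointwise (IsColouring m) l fs → h (concat fs) ≈ H (map (content m) fs)) →
    ∑ (colorings m (sum l)) h ≈ blockSum m l H
  ∑-colorings-blockwise m [] h H h≈H = trans (+-identityʳ _) (h≈H [] [])
  ∑-colorings-blockwise m (a ∷ l) h H h≈H = begin
    ∑ (colorings m (a ℕ.+ sum l)) h                                  ≈⟨ ∑-colorings-+ m a (sum l) h ⟩
    ∑[ f ← colorings m a ] ∑[ g ← colorings m (sum l) ] h (f ++ g)  ≈⟨ ∑-colorings-cong m a (λ f f-col →
                                                                         ∑-colorings-blockwise m l _ _ (λ fs ps → h≈H (f ∷ fs) (f-col ∷ ps))) ⟩
    blockSum m (a ∷ l) H                                             ∎

  ∑-vecsBelow-∷ : ∀ x xs (F : List ℕ → Carrier) →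
    ∑ (vecsBelow (x ∷ xs)) F ≈ ∑[ t ← upTo (suc x) ] ∑[ β ← vecsBelow xs ] F (t ∷ β)
  ∑-vecsBelow-∷ x xs F = trans (∑-concatMap (λ t → map (t ∷_) (vecsBelow xs)) (upTo (suc x)) F)
                               (∑-cong (upTo (suc x)) (λ t → ∑-map (t ∷_) (vecsBelow xs) F))

  blockSum-splitColumn : ∀ m i → i ≤ m → ∀ l (K : List ℕ → List (List ℕ) → Carrier) →
    blockSum (suc m) l (λ cs → K (column i cs) (map (deleteAt i) cs))
      ≈ ∑[ α ← vecsBelow l ] (natR R (binomVec l α) * blockSum m (zipWith _∸_ l α) (K α))
  blockSum-splitColumn m i i≤m [] K = sym (trans (+-identityʳ _) (natR-1-* _))
  blockSum-splitColumn m i i≤m (x ∷ xs) K = begin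
    ∑[ f ← colorings (suc m) x ] blockSum (suc m) xs (λ cs → K (column i (content (suc m) f ∷ cs)) (map (deleteAt i) (content (suc m) f ∷ cs)))
      ≈⟨ ∑-cong (colorings (suc m) x) splitRow ⟩
    ∑[ f ← colorings (suc m) x ] h (mult i f) (deleteColour i f)
      ≈⟨ ∑-colorings-splitColour m i i≤m x h ⟩
    ∑[ t ← upTo (suc x) ] (natR R (x C t) * ∑[ g ← colorings m (x ∸ t) ] h t g)
      ≈⟨ ∑-cong (upTo (suc x)) (λ t → factor (natR R (x C t)) (colorings m (x ∸ t)) (vecsBelow xs)) ⟩
    ∑[ t ← upTo (suc x) ] ∑[ β ← vecsBelow xs ]
      ((natR R (x C t) * natR R (binomVec xs β)) * blockSum m ((x ∸ t) ∷ zipWith _∸_ xs β) (K (t ∷ β)))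
      ≈⟨ ∑-cong (upTo (suc x)) (λ t → ∑-cong (vecsBelow xs) (λ β → *-congʳ (sym (natR-* (x C t) (binomVec xs β))))) ⟩
    ∑[ t ← upTo (suc x) ] ∑[ β ← vecsBelow xs ] F (t ∷ β)
      ≈⟨ ∑-vecsBelow-∷ x xs F ⟨
    ∑[ α ← vecsBelow (x ∷ xs) ] F α ∎
    where
    F : List ℕ → Carrier
    F α = natR R (binomVec (x ∷ xs) α) * blockSum m (zipWith _∸_ (x ∷ xs) α) (K α)
    h : ℕ → List ℕ → Carrier
    h t g = ∑[ β ← vecsBelow xs ] (natR R (binomVec xs β) * blockSum m (zipWith _∸_ xs β) (λ cs → K (t ∷ β) (content m g ∷ cs)))
    splitRow : ∀ f → blockSum (suc m) xs (λ cs → K (column i (content (suc m) f ∷ cs)) (map (deleteAt i) (content (suc m) f ∷ cs)))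
                       ≈ h (mult i f) (deleteColour i f)
    splitRow f = begin
      blockSum (suc m) xs (λ cs → K (entry i (content (suc m) f) ∷ column i cs) (deleteAt i (content (suc m) f) ∷ map (deleteAt i) cs))
        ≈⟨ blockSum-cong (suc m) xs (λ cs → reflexive (≡.cong₂ (λ t g → K (t ∷ column i cs) (g ∷ map (deleteAt i) cs))
                                                        (entry-applyUpTo (λ k → mult k f) (suc m) i (s≤s i≤m)) (deleteAt-content i m f i≤m))) ⟩
      blockSum (suc m) xs (λ cs → K (mult i f ∷ column i cs) (content m (deleteColour i f) ∷ map (deleteAt i) cs))
        ≈⟨ blockSum-splitColumn m i i≤m xs (λ β cs → K (mult i f ∷ β) (content m (deleteColour i f) ∷ cs)) ⟩
      h (mult i f) (deleteColour i f) ∎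
    factor : ∀ {A B : Set} a (gs : List A) (βs : List B) {b : B → Carrier} {Q : A → B → Carrier} →
      a * ∑[ g ← gs ] ∑[ β ← βs ] (b β * Q g β) ≈ ∑[ β ← βs ] ((a * b β) * ∑[ g ← gs ] Q g β)
    factor a gs βs {b} {Q} = begin
      a * ∑[ g ← gs ] ∑[ β ← βs ] (b β * Q g β)   ≈⟨ *-congˡ (∑-comm gs βs _) ⟩
      a * ∑[ β ← βs ] ∑[ g ← gs ] (b β * Q g β)   ≈⟨ *-congˡ (∑-cong βs (λ β → ∑-*ˡ gs (b β) _)) ⟩
      a * ∑[ β ← βs ] (b β * ∑[ g ← gs ] Q g β)   ≈⟨ ∑-*ˡ βs a _ ⟨
      ∑[ β ← βs ] (a * (b β * ∑[ g ← gs ] Q g β)) ≈⟨ ∑-cong βs (λ β → sym (*-assoc a (b β) _)) ⟩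
      ∑[ β ← βs ] ((a * b β) * ∑[ g ← gs ] Q g β) ∎

  -- ∏_k G_{type(π|f⁻¹(k))} if |f⁻¹(k)| = μ_k for all k, and 0 otherwise, where size k = |f⁻¹(k)|
  -- and type k lists how many elements of each block have colour k.
  profileWeight : QuasiGenus R → List ℕ → (ℕ → ℕ) → (ℕ → List ℕ) → Carrier
  profileWeight G μ size type =
    if and (zipWith (λ k μk → size k ≡ᵇ μk) (upTo (length μ)) μ)
    then prodR R (map (λ k → G (normalize (type k))) (upTo (length μ)))
    else 0#

  profileWeight-cong : ∀ G μ {size size′ : ℕ → ℕ} {type type′ : ℕ → List ℕ} →
    (∀ k → size k ≡ size′ k) → (∀ k → normalize (type k) ≡ normalize (type′ k)) →
    profileWeight G μ size type ≡ profileWeight G μ size′ type′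
  profileWeight-cong G μ size≗ type≗ = ≡.cong₂ (λ b x → if b then x else 0#)
    (≡.cong and (zipWith-cong (λ k μk → ≡.cong (_≡ᵇ μk) (size≗ k)) (upTo (length μ)) μ))
    (≡.cong (prodR R) (map-cong (λ k → ≡.cong G (type≗ k)) (upTo (length μ))))

  weight : QuasiGenus R → List ℕ → List (List ℕ) → Carrier
  weight G μ cs = profileWeight G μ (λ k → sum (column k cs)) (λ k → column k cs)

  colouringWeight : QuasiGenus R → List ℕ → ℕ → List ℕ → List ℕ → Carrier
  colouringWeight G μ b L f =
    profileWeight G μ (λ k → cnt (colourIs k) (zip L f)) (λ k → map (λ j → cnt (labelColourIs j k) (zip L f)) (upTo b))

  p≡∑colouringWeight : ∀ G l μ →
    p R G l μ ≡ ∑ (colorings (length μ) (length (blockLabels l))) (colouringWeight G μ (length l) (blockLabels l))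
  p≡∑colouringWeight G l μ = ≡.refl

  colouringWeight-concat : ∀ G μ {l fs} → Pointwise (IsColouring (length μ)) l fs →
    colouringWeight G μ (length l) (labelsFrom 0 l) (concat fs) ≡ weight G μ (map (content (length μ)) fs)
  colouringWeight-concat G μ {l} {fs} ps = profileWeight-cong G μ
    {type = λ k → map (λ j → cnt (labelColourIs j k) (zip (labelsFrom 0 l) (concat fs))) (upTo (length l))}
    {type′ = λ k → column k (map (content (length μ)) fs)}
    (λ k → ≡.trans (cnt-colourIs k (labelsFrom 0 l) (concat fs) (≡.trans (length-labelsFrom 0 l) (≡.sym (length-concat lengths))))
                   (≡.trans (mult-concat k fs) (≡.cong sum (≡.sym (column-content k ps)))))
    (λ k → ≡.cong normalize (≡.trans (labelColumn k lengths) (≡.sym (column-content k ps))))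
    where
    lengths : Pointwise (λ a f → length f ≡ a) l fs
    lengths = Pointwise.map proj₁ ps

  p≈blockSum : ∀ G l μ → p R G l μ ≈ blockSum (length μ) l (weight G μ)
  p≈blockSum G l μ = begin
    p R G l μ
      ≡⟨ p≡∑colouringWeight G l μ ⟩
    ∑ (colorings m (length (blockLabels l))) (colouringWeight G μ (length l) (blockLabels l))
      ≡⟨ ≡.cong (λ L → ∑ (colorings m (length L)) (colouringWeight G μ (length l) L)) (blockLabels≡labelsFrom l) ⟩
    ∑ (colorings m (length (labelsFrom 0 l))) (colouringWeight G μ (length l) (labelsFrom 0 l))
      ≡⟨ ≡.cong (λ n → ∑ (colorings m n) (colouringWeight G μ (length l) (labelsFrom 0 l))) (length-labelsFrom 0 l) ⟩
    ∑ (colorings m (sum l)) (colouringWeight G μ (length l) (labelsFrom 0 l))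
      ≈⟨ ∑-colorings-blockwise m l _ _ (λ fs ps → reflexive (colouringWeight-concat G μ ps)) ⟩
    blockSum m l (weight G μ) ∎
    where
    m : ℕ
    m = length μ

  profileWeight-insertAt : ∀ G i n ν size type → i ≤ length ν →
    profileWeight G (insertAt i n ν) size type
      ≈ (if size i ≡ᵇ n then G (normalize (type i)) else 0#)
        * profileWeight G ν (λ k → size (punchIn i k)) (λ k → type (punchIn i k))
  profileWeight-insertAt G i n ν size type i≤m = begin
    profileWeight G (insertAt i n ν) size type
      ≡⟨ ≡.cong (λ b → if b then prodR R (map ψ (upTo (length (insertAt i n ν)))) else 0#)
                (and-zipWith-upTo-insertAt (λ k μk → size k ≡ᵇ μk) i n ν i≤m) ⟩
    (if (size i ≡ᵇ n) ∧ _ then prodR R (map ψ (upTo (length (insertAt i n ν)))) else 0#)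
      ≈⟨ if-∧-* (size i ≡ᵇ n) _ (trans (reflexive (≡.cong (λ m → prodR R (map ψ (upTo m))) (length-insertAt i n ν)))
                                        (prodR-upTo-punchIn i (length ν) i≤m ψ)) ⟩
    (if size i ≡ᵇ n then G (normalize (type i)) else 0#)
      * profileWeight G ν (λ k → size (punchIn i k)) (λ k → type (punchIn i k)) ∎
    where
    ψ : ℕ → Carrier
    ψ k = G (normalize (type k))

  weight-insertAt : ∀ G i n ν cs → i ≤ length ν →
    weight G (insertAt i n ν) cs
      ≈ (if sum (column i cs) ≡ᵇ n then G (normalize (column i cs)) else 0#) * weight G ν (map (deleteAt i) cs)
  weight-insertAt G i n ν cs i≤m = begin
    weight G (insertAt i n ν) cs
      ≈⟨ profileWeight-insertAt G i n ν (λ k → sum (column k cs)) (λ k → column k cs) i≤m ⟩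
    (if sum (column i cs) ≡ᵇ n then G (normalize (column i cs)) else 0#)
      * profileWeight G ν (λ k → sum (column (punchIn i k) cs)) (λ k → column (punchIn i k) cs)
      ≡⟨ ≡.cong (_ *_) (profileWeight-cong G ν {type = λ k → column (punchIn i k) cs} {type′ = λ k → column k (map (deleteAt i) cs)}
                          (λ k → ≡.cong sum (≡.sym (column-deleteAt i k cs))) (λ k → ≡.cong normalize (≡.sym (column-deleteAt i k cs)))) ⟩
    (if sum (column i cs) ≡ᵇ n then G (normalize (column i cs)) else 0#) * weight G ν (map (deleteAt i) cs) ∎

  weight-cong : ∀ G μ cs cs′ → (∀ k → sum (column k cs) ≡ sum (column k cs′)) →
    (∀ k → normalize (column k cs) ≡ normalize (column k cs′)) → weight G μ cs ≡ weight G μ cs′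
  weight-cong G μ cs cs′ = profileWeight-cong G μ {type = λ k → column k cs} {type′ = λ k → column k cs′}

  weight-↭ : ∀ G μ {cs cs′} → cs ↭ cs′ → weight G μ cs ≡ weight G μ cs′
  weight-↭ G μ {cs} {cs′} p = weight-cong G μ cs cs′ (λ k → sum-↭ (↭.map⁺ (entry k) p)) (λ k → normalize-↭ (↭.map⁺ (entry k) p))

  weight-zeroRow : ∀ G μ m cs → weight G μ (content m [] ∷ cs) ≡ weight G μ cs
  weight-zeroRow G μ m cs = weight-cong G μ (content m [] ∷ cs) cs
    (λ k → ≡.cong (ℕ._+ sum (column k cs)) (entry-content m k [] []))
    (λ k → ≡.cong (λ e → normalize (e ∷ column k cs)) (entry-content m k [] []))

  Respects↭ : (List (List ℕ) → Carrier) → Set ℓ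
  Respects↭ H = ∀ {cs cs′} → cs ↭ cs′ → H cs ≈ H cs′

  blockSum-↭ : ∀ m {l l′} (H : List (List ℕ) → Carrier) → Respects↭ H → l ↭ l′ → blockSum m l H ≈ blockSum m l′ H
  blockSum-↭ m H resp ↭.refl = refl
  blockSum-↭ m H resp (↭.prep a p) =
    ∑-cong (colorings m a) (λ f → blockSum-↭ m _ (λ q → resp (↭.prep _ q)) p)
  blockSum-↭ m H resp (↭.swap {l} {l′} a b p) = trans (∑-comm (colorings m a) (colorings m b) _)
    (∑-cong (colorings m b) (λ g → ∑-cong (colorings m a) (λ f →
      trans (blockSum-cong m l (λ cs → resp (↭.swap _ _ ↭.refl)))
            (blockSum-↭ m _ (λ q → resp (↭.prep _ (↭.prep _ q))) p))))
  blockSum-↭ m H resp (↭.trans p q) = trans (blockSum-↭ m H resp p) (blockSum-↭ m H resp q)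

  blockSum-dropZeros : ∀ m l (H : List (List ℕ) → Carrier) → Respects↭ H →
    (∀ cs → H (content m [] ∷ cs) ≈ H cs) → blockSum m (dropZeros l) H ≈ blockSum m l H
  blockSum-dropZeros m [] H resp zeroRow = refl
  blockSum-dropZeros m (zero ∷ l) H resp zeroRow = trans (blockSum-dropZeros m l H resp zeroRow)
    (trans (blockSum-cong m l (λ cs → sym (zeroRow cs))) (sym (+-identityʳ _)))
  blockSum-dropZeros m (suc a ∷ l) H resp zeroRow = ∑-cong (colorings m (suc a)) (λ f →
    blockSum-dropZeros m l _ (λ q → resp (↭.prep _ q)) (λ cs → trans (resp (↭.swap _ _ ↭.refl)) (zeroRow _)))

  blockSum-normalize : ∀ m l (H : List (List ℕ) → Carrier) → Respects↭ H →
    (∀ cs → H (content m [] ∷ cs) ≈ H cs) → blockSum m (normalize l) H ≈ blockSum m l H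
  blockSum-normalize m l H resp zeroRow = trans (blockSum-↭ m H resp (normalize↭dropZeros l)) (blockSum-dropZeros m l H resp zeroRow)

  blockSum-weight≈p : ∀ G ν l → blockSum (length ν) l (weight G ν) ≈ p R G (normalize l) ν
  blockSum-weight≈p G ν l = sym (trans (p≈blockSum G (normalize l) ν)
    (blockSum-normalize (length ν) l (weight G ν) (λ q → reflexive (weight-↭ G ν q)) (λ cs → reflexive (weight-zeroRow G ν (length ν) cs))))

  p-insertDesc : ∀ G l n ν → p R G l (insertDesc n ν)
    ≈ ∑[ α ← vecsBelow l ] (if sum α ≡ᵇ n then natR R (binomVec l α) * G (normalize α) * p R G (normalize (zipWith _∸_ l α)) ν else 0#)
  p-insertDesc G l n ν with insertDesc-insertAt n ν
  ... | i , i≤m , eq = begin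
    p R G l (insertDesc n ν)
      ≡⟨ ≡.cong (p R G l) eq ⟩
    p R G l (insertAt i n ν)
      ≈⟨ p≈blockSum G l (insertAt i n ν) ⟩
    blockSum (length (insertAt i n ν)) l (weight G (insertAt i n ν))
      ≡⟨ ≡.cong (λ k → blockSum k l (weight G (insertAt i n ν))) (length-insertAt i n ν) ⟩
    blockSum (suc m) l (weight G (insertAt i n ν))
      ≈⟨ blockSum-cong (suc m) l (λ cs → weight-insertAt G i n ν cs i≤m) ⟩
    blockSum (suc m) l (λ cs → K (column i cs) (map (deleteAt i) cs))
      ≈⟨ blockSum-splitColumn m i i≤m l K ⟩
    ∑[ α ← vecsBelow l ] (natR R (binomVec l α) * blockSum m (zipWith _∸_ l α) (K α))
      ≈⟨ ∑-cong (vecsBelow l) (λ α → *-congˡ (trans (blockSum-*ˡ m (zipWith _∸_ l α) (indicator α) (weight G ν))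
                                                     (*-congˡ (blockSum-weight≈p G ν (zipWith _∸_ l α))))) ⟩
    ∑[ α ← vecsBelow l ] (natR R (binomVec l α) * (indicator α * p R G (normalize (zipWith _∸_ l α)) ν))
      ≈⟨ ∑-cong (vecsBelow l) (λ α → *-if-* _ (sum α ≡ᵇ n)) ⟩
    ∑[ α ← vecsBelow l ] (if sum α ≡ᵇ n then natR R (binomVec l α) * G (normalize α) * p R G (normalize (zipWith _∸_ l α)) ν else 0#) ∎
    where
    m : ℕ
    m = length ν
    indicator : List ℕ → Carrier
    indicator α = if sum α ≡ᵇ n then G (normalize α) else 0#
    K : List ℕ → List (List ℕ) → Carrier
    K α cs = indicator α * weight G ν cs

  -- As for blockLabels, vecsBelowOfSize filters with an unnameable where-bound helper.
  filter-unique : ∀ n {flt : List (List ℕ) → List (List ℕ)} →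
    flt [] ≡ [] → (∀ α αs → flt (α ∷ αs) ≡ (if sum α ≡ᵇ n then α ∷ flt αs else flt αs)) →
    ∀ αs → flt αs ≡ filter (λ α → sum α ≟ n) αs
  filter-unique n flt-[] flt-∷ [] = flt-[]
  filter-unique n flt-[] flt-∷ (α ∷ αs) with sum α ≡ᵇ n | flt-∷ α αs
  ... | true | eq = ≡.trans eq (≡.cong (α ∷_) (filter-unique n flt-[] flt-∷ αs))
  ... | false | eq = ≡.trans eq (filter-unique n flt-[] flt-∷ αs)

  vecsBelowOfSize≡filter : ∀ l n → vecsBelowOfSize l n ≡ filter (λ α → sum α ≟ n) (vecsBelow l)
  vecsBelowOfSize≡filter l n with vecsBelow l | filter-unique n ≡.refl (λ _ _ → ≡.refl)
  ... | αs | unique = unique αs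

  ∑-vecsBelowOfSize : ∀ l n (F : List ℕ → Carrier) →
    ∑ (vecsBelowOfSize l n) F ≈ ∑[ α ← vecsBelow l ] (if sum α ≡ᵇ n then F α else 0#)
  ∑-vecsBelowOfSize l n F = trans (reflexive (≡.cong (λ αs → ∑ αs F) (vecsBelowOfSize≡filter l n)))
                                  (∑-filter (λ α → sum α ≟ n) (vecsBelow l) F)

  D-p : ∀ G l n ν → D R n (p R G l) ν
    ≈ natR R (n !) * sumR R (map (λ α → natR R (binomVec l α) * G (normalize α) * p R G (normalize (zipWith _∸_ l α)) ν) (vecsBelowOfSize l n))
  D-p G l n ν = *-congˡ (trans (p-insertDesc G l n ν) (sym (∑-vecsBelowOfSize l n _)))

  ∑-vecsBelow-size0 : ∀ l (Φ : List ℕ → Carrier) →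
    ∑[ β ← vecsBelow l ] (if sum β ≡ᵇ 0 then Φ β else 0#) ≈ Φ (zerosLike l)
  ∑-vecsBelow-size0 [] Φ = +-identityʳ _
  ∑-vecsBelow-size0 (x ∷ l) Φ = begin
    ∑ (vecsBelow (x ∷ l)) Φ₀
      ≈⟨ ∑-vecsBelow-∷ x l Φ₀ ⟩
    ∑[ β ← vecsBelow l ] Φ₀ (0 ∷ β) + ∑[ t ← applyUpTo suc x ] ∑[ β ← vecsBelow l ] Φ₀ (t ∷ β)
      ≈⟨ +-cong (∑-vecsBelow-size0 l (λ β → Φ (0 ∷ β)))
                (trans (∑-applyUpTo suc x _) (∑-zero (upTo x) (λ t → ∑-zero (vecsBelow l) (λ β → refl)))) ⟩
    Φ (zerosLike (x ∷ l)) + 0#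
      ≈⟨ +-identityʳ _ ⟩
    Φ (zerosLike (x ∷ l)) ∎
    where
    Φ₀ : List ℕ → Carrier
    Φ₀ β = if sum β ≡ᵇ 0 then Φ β else 0#

  module _ (G : QuasiGenus R) where

    sizeOneTerm : List ℕ → (List ℕ → Carrier) → List ℕ → Carrier
    sizeOneTerm l Y β = if sum β ≡ᵇ 1 then natR R (binomVec l β) * G (normalize β) * Y (zipWith _∸_ l β) else 0#

    -- Y is kept abstract (it will be p R G (normalize ·) ν) so that the induction can pass to Y ∘ (x ∷_).
    ∑-vecsBelow-size1 : ∀ l → All (0 <_) l → (Y : List ℕ → Carrier) → (∀ {L L′} → L ↭ L′ → Y L ≈ Y L′) →
      ∑ (vecsBelow l) (sizeOneTerm l Y) ≈ ∑[ x ← l ] (natR R x * G (1 ∷ []) * Y (replaceFirst x (x ∸ 1) l))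
    ∑-vecsBelow-size1 [] [] Y Y-↭ = +-identityʳ _
    ∑-vecsBelow-size1 (suc x ∷ l) (_ ∷ l>0) Y Y-↭ = begin
      ∑ (vecsBelow (suc x ∷ l)) (sizeOneTerm (suc x ∷ l) Y)
        ≈⟨ ∑-vecsBelow-∷ (suc x) l _ ⟩
      ∑[ β ← vecsBelow l ] term (0 ∷ β)
        + (∑[ β ← vecsBelow l ] term (1 ∷ β) + ∑[ t ← applyUpTo (λ k → suc (suc k)) x ] ∑[ β ← vecsBelow l ] term (t ∷ β))
        ≈⟨ +-cong headZero (trans (+-cong headOne headMore) (+-identityʳ _)) ⟩
      ∑ (vecsBelow l) (sizeOneTerm l (λ L → Y (suc x ∷ L))) + natR R (suc x) * G (1 ∷ []) * Y (x ∷ l)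
        ≈⟨ +-congʳ (∑-vecsBelow-size1 l l>0 _ (λ p → Y-↭ (↭.prep (suc x) p))) ⟩
      ∑[ y ← l ] (natR R y * G (1 ∷ []) * Y (suc x ∷ replaceFirst y (y ∸ 1) l)) + natR R (suc x) * G (1 ∷ []) * Y (x ∷ l)
        ≈⟨ +-comm _ _ ⟩
      natR R (suc x) * G (1 ∷ []) * Y (x ∷ l) + ∑[ y ← l ] (natR R y * G (1 ∷ []) * Y (suc x ∷ replaceFirst y (y ∸ 1) l))
        ≈⟨ +-cong (*-congˡ (reflexive (≡.cong (λ b → Y (if b then x ∷ l else suc x ∷ replaceFirst (suc x) x l)) (≡.sym (≡ᵇ-refl x)))))
                  (∑-cong-∈ l (λ {y} y∈l → *-congˡ (Y-↭ (∷-replaceFirst-↭ (suc x) (y ∸ 1) l y∈l)))) ⟩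
      ∑[ y ← suc x ∷ l ] (natR R y * G (1 ∷ []) * Y (replaceFirst y (y ∸ 1) (suc x ∷ l))) ∎
      where
      term : List ℕ → Carrier
      term = sizeOneTerm (suc x ∷ l) Y

      headZero : ∑[ β ← vecsBelow l ] term (0 ∷ β) ≈ ∑ (vecsBelow l) (sizeOneTerm l (λ L → Y (suc x ∷ L)))
      headZero = ∑-cong (vecsBelow l) (λ β → reflexive (≡.cong
        (λ b → if sum β ≡ᵇ 1 then natR R b * G (normalize β) * Y (suc x ∷ zipWith _∸_ l β) else 0#) (ℕ.+-identityʳ (binomVec l β))))

      headOne : ∑[ β ← vecsBelow l ] term (1 ∷ β) ≈ natR R (suc x) * G (1 ∷ []) * Y (x ∷ l)
      headOne = trans (∑-vecsBelow-size0 l (λ β → natR R ((suc x C 1) ℕ.* binomVec l β) * G (normalize (1 ∷ β)) * Y (x ∷ zipWith _∸_ l β)))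
        (*-cong (*-cong (reflexive (≡.cong (natR R) binom≡)) (reflexive (≡.cong G (normalize-1∷zerosLike l))))
                (reflexive (≡.cong (λ L → Y (x ∷ L)) (zipWith-∸-zerosLike l))))
        where
        binom≡ : (suc x C 1) ℕ.* binomVec l (zerosLike l) ≡ suc x
        binom≡ = ≡.trans (≡.cong₂ ℕ._*_ (nC1≡n (suc x)) (binomVec-zerosLike l)) (ℕ.*-identityʳ (suc x))

      headMore : ∑[ t ← applyUpTo (λ k → suc (suc k)) x ] ∑[ β ← vecsBelow l ] term (t ∷ β) ≈ 0#
      headMore = trans (∑-applyUpTo (λ k → suc (suc k)) x _) (∑-zero (upTo x) (λ t → ∑-zero (vecsBelow l) (λ β → refl)))

  ∑-byMultiplicity : ∀ N l (φ : ℕ → Carrier) → All (λ x → 0 < x × x ≤ N) l →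
    ∑ l φ ≈ ∑[ i ← applyUpTo suc N ] (natR R (mult i l) * φ i)
  ∑-byMultiplicity N [] φ [] = sym (∑-zero (applyUpTo suc N) (λ i → zeroˡ (φ i)))
  ∑-byMultiplicity N (zero ∷ l) φ ((() , _) ∷ _)
  ∑-byMultiplicity N (suc x ∷ l) φ ((_ , x<N) ∷ bounds) = sym (begin
    ∑[ i ← applyUpTo suc N ] (natR R (mult i (suc x ∷ l)) * φ i)
      ≈⟨ ∑-cong (applyUpTo suc N) split ⟩
    ∑[ i ← applyUpTo suc N ] ((if suc x ≡ᵇ i then φ i else 0#) + natR R (mult i l) * φ i)
      ≈⟨ ∑-+ (applyUpTo suc N) _ _ ⟩
    ∑[ i ← applyUpTo suc N ] (if suc x ≡ᵇ i then φ i else 0#) + ∑[ i ← applyUpTo suc N ] (natR R (mult i l) * φ i)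
      ≈⟨ +-cong (trans (∑-applyUpTo suc N _) (∑-upTo-indicator x<N (λ t → φ (suc t)))) (sym (∑-byMultiplicity N l φ bounds)) ⟩
    φ (suc x) + ∑ l φ ∎)
    where
    split : ∀ i → natR R (mult i (suc x ∷ l)) * φ i ≈ (if suc x ≡ᵇ i then φ i else 0#) + natR R (mult i l) * φ i
    split i with suc x ≡ᵇ i
    ... | true = trans (distribʳ _ _ _) (+-congʳ (*-identityˡ _))
    ... | false = sym (+-identityˡ _)

  D₁-p : ∀ G l → All (0 <_) l → ∀ ν → D R 1 (p R G l) ν
    ≈ sumR R (map (λ i → natR R i * G (1 ∷ []) * natR R (mult i l) * p R G (replaceOne i l) ν) (applyUpTo suc (sum l)))
  D₁-p G l l>0 ν = begin
    natR R 1 * p R G l (insertDesc 1 ν)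
      ≈⟨ natR-1-* _ ⟩
    p R G l (insertDesc 1 ν)
      ≈⟨ p-insertDesc G l 1 ν ⟩
    ∑ (vecsBelow l) (sizeOneTerm G l Y)
      ≈⟨ ∑-vecsBelow-size1 G l l>0 Y (λ q → reflexive (≡.cong (λ L → p R G L ν) (normalize-↭ q))) ⟩
    ∑ l φ
      ≈⟨ ∑-byMultiplicity (sum l) l φ (All.zip (l>0 , All-≤-sum l)) ⟩
    ∑[ i ← applyUpTo suc (sum l) ] (natR R (mult i l) * φ i)
      ≈⟨ ∑-cong (applyUpTo suc (sum l)) (λ i → trans (sym (*-assoc _ _ _)) (*-congʳ (*-comm _ _))) ⟩
    ∑[ i ← applyUpTo suc (sum l) ] (natR R i * G (1 ∷ []) * natR R (mult i l) * p R G (replaceOne i l) ν) ∎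
    where
    Y : List ℕ → Carrier
    Y L = p R G (normalize L) ν
    φ : ℕ → Carrier
    φ i = natR R i * G (1 ∷ []) * p R G (replaceOne i l) ν

proposition4 : {c ℓ : Level} (R : CommutativeRing c ℓ) →
    let open CommutativeRing R in
    (G : QuasiGenus R) →
    G [] ≈ 1# → ¬ (G (1 ∷ []) ≈ 0#) → Full R G →
    (l : List ℕ) → IsPartition l →
      ((ν : List ℕ) → IsPartition ν →
        D R 1 (p R G l) ν
          ≈ sumR R (map (λ i → natR R i * G (1 ∷ []) * natR R (mult i l) * p R G (replaceOne i l) ν)
                        (applyUpTo suc (sum l))))
    × ((n : ℕ) → 1 ≤ n → (ν : List ℕ) → IsPartition ν →
        D R n (p R G l) ν
          ≈ natR R (n !) * sumR R (map (λ α → natR R (binomVec l α) * G (normalize α) * p R G (normalize (zipWith _∸_ l α)) ν)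
                                       (vecsBelowOfSize l n)))
proposition4 R G _ _ _ l (l>0 , _) = (λ ν _ → D₁-p R G l l>0 ν) , (λ n _ ν _ → D-p R G l n ν)
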